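{- Let $m\ge 3$, $n\ge 2$, let $W_m$ be the wheel with $m$ rim vertices and $P_n$ the path on $n$ vertices, and let $\Delta$ be the maximum degree of $W_m\times P_n$. Then $$\chi''_{\Sigma}(W_m\times P_n)=\begin{cases}\Delta+1 & \text{if } n=3 \text{ and } m\ge 4,\\ \Delta+2 & \text{otherwise.}\end{cases}$$
   Context: All graphs are finite and simple. A proper total $k$-coloring of a graph $G$ assigns to every vertex and every edge a color from $\{1,\dots,k\}$ such that adjacent vertices receive different colors, edges sharing an endpoint receive different colors, and no edge receives the same color as either of its endpoints. For such a coloring $c$ and a vertex $v$, let $f(v)=c(v)+\sum_{e\ni v} c(e)$. The coloring distinguishes adjacent vertices by sums if $f(u)\neq f(v)$ for every edge $uv$. $\chi''_{\Sigma}(G)$ denotes the smallest $k$ such that $G$ has a proper total $k$-coloring distinguishing adjacent vertices by sums. The product $G_1\times G_2$ is the Cartesian product: vertex set $V(G_1)\times V(G_2)$, with $(u_1,u_2)$ adjacent to $(v_1,v_2)$ iff either $u_1=v_1$ and $u_2v_2\in E(G_2)$, or $u_1v_1\in E(G_1)$ and $u_2=v_2$. The wheel $W_m$ consists of a cycle on $m$ vertices together with a central vertex adjacent to all of them ($W_3=K_4$). -}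

module Defs where

open import Data.Nat using (ℕ; zero; suc; _+_; _*_; _≤_; _<_; _⊔_; _≡ᵇ_)
open import Data.Bool using (Bool; true; false; _∨_; _∧_; if_then_else_; T)
open import Data.Fin using (Fin; toℕ; remQuot)
open import Data.List using (List; foldr; map; allFin)
open import Data.Nat.ListAction using (sum)
open import Data.Product using (Σ; _×_; _,_; proj₁; proj₂)
open import Relation.Binary.PropositionalEquality using (_≡_; _≢_)
open import Relation.Nullary using (¬_)

record Graph : Set where
  field
    V   : ℕ
    adj : Fin V → Fin V → Bool
open Graph public

IsSimple : Graph → Set
IsSimple G = (∀ u v → adj G u v ≡ adj G v u) × (∀ u → adj G u u ≡ false)

pathGraph : ℕ → Graph
pathGraph n = record { V = n ; adj = λ a b → (suc (toℕ a) ≡ᵇ toℕ b) ∨ (suc (toℕ b) ≡ᵇ toℕ a) }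

cycAdj : ℕ → ℕ → ℕ → Bool
cycAdj m a b = (suc a ≡ᵇ b) ∨ (suc b ≡ᵇ a) ∨ ((a ≡ᵇ 0) ∧ (suc b ≡ᵇ m)) ∨ ((b ≡ᵇ 0) ∧ (suc a ≡ᵇ m))

-- Wheel W_m: vertex 0 is the centre, vertices 1..m form the rim cycle.
wheelAdj : (m : ℕ) → Fin (suc m) → Fin (suc m) → Bool
wheelAdj m Fin.zero Fin.zero = false
wheelAdj m Fin.zero (Fin.suc _) = true
wheelAdj m (Fin.suc _) Fin.zero = true
wheelAdj m (Fin.suc i) (Fin.suc j) = cycAdj m (toℕ i) (toℕ j)

wheel : ℕ → Graph
wheel m = record { V = suc m ; adj = wheelAdj m }

-- Cartesian product; vertex x of G₁ × G₂ encodes the pair remQuot x.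
_□_ : Graph → Graph → Graph
G₁ □ G₂ = record
  { V   = V G₁ * V G₂
  ; adj = λ x y →
      let (u₁ , u₂) = remQuot (V G₂) x
          (v₁ , v₂) = remQuot (V G₂) y
      in ((toℕ u₁ ≡ᵇ toℕ v₁) ∧ adj G₂ u₂ v₂) ∨ (adj G₁ u₁ v₁ ∧ (toℕ u₂ ≡ᵇ toℕ v₂)) }

Adj : (G : Graph) → Fin (V G) → Fin (V G) → Set
Adj G u v = T (adj G u v)

degree : (G : Graph) → Fin (V G) → ℕ
degree G v = sum (map (λ w → if adj G v w then 1 else 0) (allFin (V G)))

maxDegree : Graph → ℕ
maxDegree G = foldr _⊔_ 0 (map (degree G) (allFin (V G)))

-- A total colouring: colours of vertices and of (ordered pairs representing) edges.
record TotalColouring (G : Graph) : Set where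
  field
    cv : Fin (V G) → ℕ
    ce : Fin (V G) → Fin (V G) → ℕ
open TotalColouring public

weight : (G : Graph) → TotalColouring G → Fin (V G) → ℕ
weight G c v = cv c v + sum (map (λ w → if adj G v w then ce c v w else 0) (allFin (V G)))

IsSumDistTotal : (G : Graph) → ℕ → TotalColouring G → Set
IsSumDistTotal G k c =
    (∀ v → 1 ≤ cv c v × cv c v ≤ k)
  × (∀ u v → Adj G u v → 1 ≤ ce c u v × ce c u v ≤ k)
  × (∀ u v → Adj G u v → ce c u v ≡ ce c v u)
  × (∀ u v → Adj G u v → cv c u ≢ cv c v)
  × (∀ u v w → Adj G u v → Adj G u w → v ≢ w → ce c u v ≢ ce c u w)
  × (∀ u v → Adj G u v → ce c u v ≢ cv c u)
  × (∀ u v → Adj G u v → weight G c u ≢ weight G c v)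

HasSumDistTotal : Graph → ℕ → Set
HasSumDistTotal G k = Σ (TotalColouring G) (IsSumDistTotal G k)

ChiSigmaIs : Graph → ℕ → Set
ChiSigmaIs G k = HasSumDistTotal G k × (∀ j → j < k → ¬ HasSumDistTotal G j)

-- In a proper total colouring with colours 1, …, k a vertex v sees
-- deg v + 1 distinct colours (its own and those of its edges), so k ≥ Δ + 1; and if
-- k = Δ + 1, every vertex of maximum degree sees all of 1, …, k and has weight
-- k (k + 1) / 2, so two adjacent vertices of maximum degree force k ≥ Δ + 2.  In
-- W_m × P_n the maximum degree is m + 1 for n = 2 and m + 2 for n ≥ 3, attained at the
-- centres of the inner layers; two of these are adjacent unless n = 3, and for n = 3 a
-- rim vertex of the middle layer also has degree m + 2 exactly when m = 3.
--
-- Explicit colourings described layer by layer: for m ≥ 5 the wheel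
-- elements are coloured cyclically from 1, …, m and the centres and rungs from
-- m + 1, …, m + 4; for m = 3, 4 by a table depending only on the kind of the layer,
-- checked by computation.
module Submission where

open import Defs
open import Data.Nat
open import Data.Nat.Properties
open import Data.Nat.DivMod
open import Data.Nat.ListAction using (sum)
open import Data.Nat.Tactic.RingSolver using (solve-∀)
open import Data.Bool using (Bool; true; false; not; _∨_; _∧_; if_then_else_; T)
open import Data.Bool.Properties using (T-∨; T-∧; T-≡)
open import Data.Fin as Fin using (Fin; toℕ; remQuot; combine; _↑ˡ_; _↑ʳ_)
open import Data.Fin.Properties
  using (toℕ<n; toℕ-injective; splitAt-↑ˡ; splitAt-↑ʳ; remQuot-combine; combine-remQuot)
open import Data.List using (List; []; _∷_; map; allFin; tabulate; length; foldr; filterᵇ)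
open import Data.List.Properties using (map-tabulate; length-map)
open import Data.List.Membership.Propositional using (_∈_)
open import Data.List.Membership.Propositional.Properties using (∈-allFin)
open import Data.List.Relation.Unary.All as All using (All; []; _∷_)
open import Data.List.Relation.Unary.AllPairs using ([]; _∷_)
open import Data.List.Relation.Unary.Any using (here; there)
open import Data.List.Relation.Unary.All.Properties using (all-filter; map⁺)
open import Data.List.Relation.Unary.Unique.Propositional using (Unique)
open import Data.List.Relation.Unary.Unique.Propositional.Properties using (allFin⁺; filter⁺)
open import Data.Product using (_×_; _,_; proj₁; proj₂)
open import Data.Sum using (_⊎_; inj₁; inj₂; [_,_]′)
open import Data.Empty using (⊥; ⊥-elim)
open import Data.Unit using (⊤; tt)
open import Function using (_∘_; id)
open import Function.Bundles using (Equivalence)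
open import Relation.Binary.PropositionalEquality hiding ([_])
open import Relation.Nullary using (¬_; yes; no)
open import Relation.Nullary.Decidable using (T?)

≡ᵇ-sym : ∀ a b → (a ≡ᵇ b) ≡ (b ≡ᵇ a)
≡ᵇ-sym zero    zero    = refl
≡ᵇ-sym zero    (suc b) = refl
≡ᵇ-sym (suc a) zero    = refl
≡ᵇ-sym (suc a) (suc b) = ≡ᵇ-sym a b

≡ᵇ-true : ∀ a b → a ≡ b → (a ≡ᵇ b) ≡ true
≡ᵇ-true a b e = Equivalence.to T-≡ (≡⇒≡ᵇ a b e)

¬T⇒≡false : ∀ {b} → ¬ T b → b ≡ false
¬T⇒≡false {true}  ¬t = ⊥-elim (¬t tt)
¬T⇒≡false {false} _  = refl

≡ᵇ-false : ∀ a b → a ≢ b → (a ≡ᵇ b) ≡ false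
≡ᵇ-false a b a≢b = ¬T⇒≡false (a≢b ∘ ≡ᵇ⇒≡ a b)

<ᵇ-true : ∀ {a N} → a < N → (a <ᵇ N) ≡ true
<ᵇ-true a<N = Equivalence.to T-≡ (<⇒<ᵇ a<N)

infix 7 [_]_
[_]_ : Bool → ℕ → ℕ
[ b ] x = if b then x else 0

sumFin : (N : ℕ) → (Fin N → ℕ) → ℕ
sumFin zero    f = 0
sumFin (suc N) f = f Fin.zero + sumFin N (f ∘ Fin.suc)

sumℕ : ℕ → (ℕ → ℕ) → ℕ
sumℕ zero    f = 0
sumℕ (suc N) f = f 0 + sumℕ N (f ∘ suc)

sum-map-allFin : ∀ N (f : Fin N → ℕ) → sum (map f (allFin N)) ≡ sumFin N f
sum-map-allFin N f = trans (cong sum (map-tabulate id f)) (sum-tabulate N f)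
  where
  sum-tabulate : ∀ N (f : Fin N → ℕ) → sum (tabulate f) ≡ sumFin N f
  sum-tabulate zero    f = refl
  sum-tabulate (suc N) f = cong (f Fin.zero +_) (sum-tabulate N (f ∘ Fin.suc))

sumFin-cong : ∀ N {f g : Fin N → ℕ} → (∀ i → f i ≡ g i) → sumFin N f ≡ sumFin N g
sumFin-cong zero    e = refl
sumFin-cong (suc N) e = cong₂ _+_ (e Fin.zero) (sumFin-cong N (e ∘ Fin.suc))

sumFin-+ : ∀ a b (f : Fin (a + b) → ℕ) →
  sumFin (a + b) f ≡ sumFin a (f ∘ (_↑ˡ b)) + sumFin b (f ∘ (a ↑ʳ_))
sumFin-+ zero    b f = refl
sumFin-+ (suc a) b f =
  trans (cong (f Fin.zero +_) (sumFin-+ a b (f ∘ Fin.suc))) (sym (+-assoc (f Fin.zero) _ _))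

sumFin-remQuot : ∀ M n (g : Fin M × Fin n → ℕ) →
  sumFin (M * n) (g ∘ remQuot {M} n) ≡ sumFin M (λ i → sumFin n (λ j → g (i , j)))
sumFin-remQuot zero    n g = refl
sumFin-remQuot (suc M) n g = begin
  sumFin (n + M * n) (g ∘ remQuot {suc M} n)
    ≡⟨ sumFin-+ n (M * n) _ ⟩
  sumFin n (λ j → g (remQuot {suc M} n (j ↑ˡ (M * n))))
    + sumFin (M * n) (λ i → g (remQuot {suc M} n (n ↑ʳ i)))
    ≡⟨ cong₂ _+_ (sumFin-cong n (λ j → cong g (remQuot-↑ˡ j)))
                 (sumFin-cong (M * n) (λ i → cong g (remQuot-↑ʳ i))) ⟩
  sumFin n (λ j → g (Fin.zero , j)) + sumFin (M * n) (g′ ∘ remQuot {M} n)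
    ≡⟨ cong (sumFin n (λ j → g (Fin.zero , j)) +_) (sumFin-remQuot M n g′) ⟩
  sumFin n (λ j → g (Fin.zero , j)) + sumFin M (λ i → sumFin n (λ j → g (Fin.suc i , j))) ∎
  where
  open ≡-Reasoning
  g′ : Fin M × Fin n → ℕ
  g′ (i , j) = g (Fin.suc i , j)
  remQuot-↑ˡ : ∀ j → remQuot {suc M} n (j ↑ˡ (M * n)) ≡ (Fin.zero , j)
  remQuot-↑ˡ j rewrite splitAt-↑ˡ n j (M * n) = refl
  remQuot-↑ʳ : ∀ i → remQuot {suc M} n (n ↑ʳ i)
                   ≡ (Fin.suc (proj₁ (remQuot {M} n i)) , proj₂ (remQuot {M} n i))
  remQuot-↑ʳ i rewrite splitAt-↑ʳ n (M * n) i = refl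

sumFin-toℕ : ∀ N (f : ℕ → ℕ) → sumFin N (f ∘ toℕ) ≡ sumℕ N f
sumFin-toℕ zero    f = refl
sumFin-toℕ (suc N) f = cong (f 0 +_) (sumFin-toℕ N (f ∘ suc))

sumℕ-cong : ∀ N {f g : ℕ → ℕ} → (∀ i → i < N → f i ≡ g i) → sumℕ N f ≡ sumℕ N g
sumℕ-cong zero    e = refl
sumℕ-cong (suc N) e = cong₂ _+_ (e 0 z<s) (sumℕ-cong N (λ i i<N → e (suc i) (s<s i<N)))

sumℕ-mono : ∀ N {f g : ℕ → ℕ} → (∀ i → f i ≤ g i) → sumℕ N f ≤ sumℕ N g
sumℕ-mono zero    h = z≤n
sumℕ-mono (suc N) h = +-mono-≤ (h 0) (sumℕ-mono N (h ∘ suc))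

sumℕ-+ : ∀ N (f g : ℕ → ℕ) → sumℕ N (λ i → f i + g i) ≡ sumℕ N f + sumℕ N g
sumℕ-+ zero    f g = refl
sumℕ-+ (suc N) f g rewrite sumℕ-+ N (f ∘ suc) (g ∘ suc) =
  +-+-comm (f 0) (g 0) (sumℕ N (f ∘ suc)) (sumℕ N (g ∘ suc))
  where
  +-+-comm : ∀ a b c d → a + b + (c + d) ≡ a + c + (b + d)
  +-+-comm = solve-∀

sumℕ-const : ∀ N c → sumℕ N (λ _ → c) ≡ N * c
sumℕ-const zero    c = refl
sumℕ-const (suc N) c = cong (c +_) (sumℕ-const N c)

sumℕ-zero : ∀ N → sumℕ N (λ _ → 0) ≡ 0
sumℕ-zero N = trans (sumℕ-const N 0) (*-zeroʳ N)

sumℕ-pull-indicator : ∀ N b (f : ℕ → ℕ) → sumℕ N (λ i → [ b ] f i) ≡ ([ b ] sumℕ N f)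
sumℕ-pull-indicator N true  f = refl
sumℕ-pull-indicator N false f = sumℕ-zero N

sumℕ-indicator : ∀ N t (f : ℕ → ℕ) →
  sumℕ N (λ i → [ t ≡ᵇ i ] f i) ≡ ([ t <ᵇ N ] f t)
sumℕ-indicator zero    t       f = refl
sumℕ-indicator (suc N) zero    f = trans (cong (f 0 +_) (sumℕ-zero N)) (+-identityʳ (f 0))
sumℕ-indicator (suc N) (suc t) f = sumℕ-indicator N t (f ∘ suc)

indicator-∨ : ∀ a b (e : ℕ) → (a ∧ b) ≡ false →
  ([ a ∨ b ] e) ≡ ([ a ] e) + ([ b ] e)
indicator-∨ true  true  e ()
indicator-∨ true  false e _ = sym (+-identityʳ e)
indicator-∨ false true  e _ = refl
indicator-∨ false false e _ = refl

indicator-∧∨∧ : ∀ a b c d (e : ℕ) → (a ∧ c) ≡ false →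
  ([ (a ∧ b) ∨ (c ∧ d) ] e)
    ≡ ([ a ] ([ b ] e)) + ([ c ] ([ d ] e))
indicator-∧∨∧ true  b     true  d e ()
indicator-∧∨∧ true  true  false d e _ = sym (+-identityʳ e)
indicator-∧∨∧ true  false false d e _ = refl
indicator-∧∨∧ false b     true  d e _ = refl
indicator-∧∨∧ false b     false d e _ = refl

predTerm : ℕ → (ℕ → ℕ) → ℕ → ℕ
predTerm N f zero    = 0
predTerm N f (suc t) = [ t <ᵇ N ] f t

sumℕ-indicator-suc : ∀ N t (f : ℕ → ℕ) →
  sumℕ N (λ i → [ suc i ≡ᵇ t ] f i) ≡ predTerm N f t
sumℕ-indicator-suc N zero    f = sumℕ-zero N
sumℕ-indicator-suc N (suc t) f =
  trans (sumℕ-cong N (λ i _ → cong (λ b → [ b ] f i) (≡ᵇ-sym i t))) (sumℕ-indicator N t f)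

-- The rim of the wheel W_m: vertex r of the cycle is rim vertex suc r of the wheel.
module Rim (m0 : ℕ) where

  m : ℕ
  m = 3 + m0

  next : ℕ → ℕ
  next r = if suc r ≡ᵇ m then 0 else suc r

  prev : ℕ → ℕ
  prev zero    = 2 + m0
  prev (suc r) = r

  data NextView (r : ℕ) : Set where
    wrap : suc r ≡ m → next r ≡ 0 → NextView r
    step : suc r ≢ m → next r ≡ suc r → NextView r

  nextView : ∀ r → NextView r
  nextView r with suc r ≟ m
  ... | yes e = wrap e (cong (λ b → if b then 0 else suc r) (≡ᵇ-true (suc r) m e))
  ... | no ne = step ne (cong (λ b → if b then 0 else suc r) (≡ᵇ-false (suc r) m ne))

  next<m : ∀ {r} → r < m → next r < m
  next<m {r} r<m with nextView r
  ... | wrap _ e  rewrite e = z<s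
  ... | step ne e rewrite e = ≤∧≢⇒< r<m ne

  prev<m : ∀ {r} → r < m → prev r < m
  prev<m {zero}  _   = ≤-refl
  prev<m {suc r} r<m = <-trans (n<1+n r) r<m

  prev-next : ∀ {r} → r < m → prev (next r) ≡ r
  prev-next {r} r<m with nextView r
  ... | wrap e e′ rewrite e′ = cong pred (sym e)
  ... | step _ e′ rewrite e′ = refl

  next-prev : ∀ {r} → r < m → next (prev r) ≡ r
  next-prev {zero} r<m with nextView (2 + m0)
  ... | wrap _ e  = e
  ... | step ne _ = ⊥-elim (ne refl)
  next-prev {suc r} r<m with nextView r
  ... | wrap e _ = ⊥-elim (<-irrefl e r<m)
  ... | step _ e = e

  next≢prev : ∀ {r} → r < m → next r ≢ prev r
  next≢prev {r} r<m eq with nextView r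
  next≢prev {zero}  _ eq | wrap () _
  next≢prev {suc r} _ eq | wrap e e′ with trans (sym e′) eq
  next≢prev {suc r} _ eq | wrap () e′ | refl
  next≢prev {zero}  _ eq | step _ e′ with trans (sym e′) eq
  ... | ()
  next≢prev {suc r} _ eq | step _ e′ = 2+n≢n (trans (sym e′) eq)
    where
    2+n≢n : ∀ {k} → suc (suc k) ≢ k
    2+n≢n ()

  cycAdj⇒next⊎prev : ∀ {r r′} → r < m → r′ < m → T (cycAdj m r r′) → r′ ≡ next r ⊎ r′ ≡ prev r
  cycAdj⇒next⊎prev {r} {r′} r<m r′<m t with Equivalence.to (T-∨ {suc r ≡ᵇ r′}) t
  ... | inj₁ t₁ with ≡ᵇ⇒≡ (suc r) r′ t₁
  ...   | refl with nextView r
  ...     | wrap e _ = ⊥-elim (<-irrefl e r′<m)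
  ...     | step _ e = inj₁ (sym e)
  cycAdj⇒next⊎prev {r} {r′} r<m r′<m t | inj₂ t′ with Equivalence.to (T-∨ {suc r′ ≡ᵇ r}) t′
  ... | inj₁ t₂ with ≡ᵇ⇒≡ (suc r′) r t₂
  ...   | refl = inj₂ refl
  cycAdj⇒next⊎prev {r} {r′} r<m r′<m t | inj₂ t′ | inj₂ t″
    with Equivalence.to (T-∨ {(r ≡ᵇ 0) ∧ (suc r′ ≡ᵇ m)}) t″
  ... | inj₁ t₃ with Equivalence.to (T-∧ {r ≡ᵇ 0}) t₃
  ...   | (a , b) with ≡ᵇ⇒≡ r 0 a | ≡ᵇ⇒≡ (suc r′) m b
  ...     | refl | refl = inj₂ refl
  cycAdj⇒next⊎prev {r} {r′} r<m r′<m t | inj₂ t′ | inj₂ t″ | inj₂ t₄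
    with Equivalence.to (T-∧ {r′ ≡ᵇ 0}) t₄
  ... | (a , b) with ≡ᵇ⇒≡ r′ 0 a | nextView r
  ...   | refl | wrap _ e  = inj₁ (sym e)
  ...   | refl | step ne _ = ⊥-elim (ne (≡ᵇ⇒≡ (suc r) m b))

  cycAdj-next : ∀ {r} → r < m → cycAdj m r (next r) ≡ true
  cycAdj-next {r} r<m with nextView r
  ... | wrap e e′ rewrite e′ | ≡ᵇ-true (suc r) m e = lemma (suc r ≡ᵇ 0) (1 ≡ᵇ r) ((r ≡ᵇ 0) ∧ (1 ≡ᵇ m))
    where
    lemma : ∀ a b c → a ∨ b ∨ c ∨ true ≡ true
    lemma true  _     _     = refl
    lemma false true  _     = refl
    lemma false false true  = refl
    lemma false false false = refl
  ... | step _ e′ rewrite e′ | ≡ᵇ-true r r refl = refl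

  cycAdj-prev : ∀ {r} → r < m → cycAdj m r (prev r) ≡ true
  cycAdj-prev {zero}  _ rewrite ≡ᵇ-true m0 m0 refl = refl
  cycAdj-prev {suc r} _ rewrite ≡ᵇ-true r r refl = lemma (suc (suc r) ≡ᵇ r)
    where
    lemma : ∀ a → a ∨ true ≡ true
    lemma true  = refl
    lemma false = refl

  -- The neighbours of r on the cycle are exactly next r and prev r, which are distinct.
  cycAdj-split : ∀ {r r′} → r < m → r′ < m → (f : ℕ → ℕ) →
    ([ cycAdj m r r′ ] f r′)
      ≡ ([ next r ≡ᵇ r′ ] f r′) + ([ prev r ≡ᵇ r′ ] f r′)
  cycAdj-split {r} {r′} r<m r′<m f with r′ ≟ next r
  ... | yes refl rewrite cycAdj-next r<m | ≡ᵇ-true (next r) (next r) refl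
                       | ≡ᵇ-false (prev r) (next r) (next≢prev r<m ∘ sym) = sym (+-identityʳ _)
  ... | no ne₁ with r′ ≟ prev r
  ...   | yes refl rewrite cycAdj-prev r<m | ≡ᵇ-true (prev r) (prev r) refl
                         | ≡ᵇ-false (next r) (prev r) (next≢prev r<m) = refl
  ...   | no ne₂ rewrite ≡ᵇ-false (next r) r′ (ne₁ ∘ sym) | ≡ᵇ-false (prev r) r′ (ne₂ ∘ sym)
                       | ¬T⇒≡false ([ ne₁ , ne₂ ]′ ∘ cycAdj⇒next⊎prev r<m r′<m) = refl

-- Vertex x of W_m □ P_n is the wheel vertex 'column x' (0 the centre, suc r the rim
-- vertex r) in the copy 'layer x' of the wheel.
module Product (m0 n : ℕ) where
  open Rim m0 public

  G : Graph
  G = wheel m □ pathGraph n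

  wheelAdjℕ : ℕ → ℕ → Bool
  wheelAdjℕ zero    zero    = false
  wheelAdjℕ zero    (suc _) = true
  wheelAdjℕ (suc _) zero    = true
  wheelAdjℕ (suc a) (suc b) = cycAdj m a b

  pathAdjℕ : ℕ → ℕ → Bool
  pathAdjℕ l l′ = (suc l ≡ᵇ l′) ∨ (suc l′ ≡ᵇ l)

  adjℕ : ℕ → ℕ → ℕ → ℕ → Bool
  adjℕ a l a′ l′ = ((a ≡ᵇ a′) ∧ pathAdjℕ l l′) ∨ (wheelAdjℕ a a′ ∧ (l ≡ᵇ l′))

  column : Fin (V G) → ℕ
  column x = toℕ (proj₁ (remQuot {suc m} n x))

  layer : Fin (V G) → ℕ
  layer x = toℕ (proj₂ (remQuot {suc m} n x))

  column<1+m : ∀ x → column x < suc m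
  column<1+m x = toℕ<n (proj₁ (remQuot {suc m} n x))

  layer<n : ∀ x → layer x < n
  layer<n x = toℕ<n (proj₂ (remQuot {suc m} n x))

  coords-injective : ∀ {x y} → column x ≡ column y → layer x ≡ layer y → x ≡ y
  coords-injective {x} {y} e₁ e₂ = trans (sym (combine-remQuot {suc m} n x))
    (trans (cong₂ combine (toℕ-injective e₁) (toℕ-injective e₂)) (combine-remQuot {suc m} n y))

  adj≡adjℕ : ∀ x y → adj G x y ≡ adjℕ (column x) (layer x) (column y) (layer y)
  adj≡adjℕ x y = cong (λ b → ((column x ≡ᵇ column y) ∧ pathAdjℕ (layer x) (layer y))
                               ∨ (b ∧ (layer x ≡ᵇ layer y)))
                      (wheelAdj≡ (proj₁ (remQuot {suc m} n x)) (proj₁ (remQuot {suc m} n y)))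
    where
    wheelAdj≡ : ∀ (u v : Fin (suc m)) → wheelAdj m u v ≡ wheelAdjℕ (toℕ u) (toℕ v)
    wheelAdj≡ Fin.zero    Fin.zero    = refl
    wheelAdj≡ Fin.zero    (Fin.suc v) = refl
    wheelAdj≡ (Fin.suc u) Fin.zero    = refl
    wheelAdj≡ (Fin.suc u) (Fin.suc v) = refl

  pathNbrSum : ℕ → ℕ → (ℕ → ℕ → ℕ) → ℕ
  pathNbrSum a l E = ([ suc l <ᵇ n ] E a (suc l)) + predTerm n (E a) l

  wheelNbrSum : ℕ → ℕ → (ℕ → ℕ → ℕ) → ℕ
  wheelNbrSum zero    l E = sumℕ m (λ r → E (suc r) l)
  wheelNbrSum (suc r) l E = E 0 l + (E (suc (next r)) l + E (suc (prev r)) l)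

  nbrSum : ℕ → ℕ → (ℕ → ℕ → ℕ) → ℕ
  nbrSum a l E = pathNbrSum a l E + wheelNbrSum a l E

  wheelAdjℕ-irrefl : ∀ a → wheelAdjℕ a a ≡ false
  wheelAdjℕ-irrefl zero    = refl
  wheelAdjℕ-irrefl (suc zero) = refl
  wheelAdjℕ-irrefl (suc (suc a)) rewrite ≡ᵇ-false (suc (suc a)) (suc a) (λ ()) = refl

  wheel-and-path-disjoint : ∀ a a′ → ((a ≡ᵇ a′) ∧ wheelAdjℕ a a′) ≡ false
  wheel-and-path-disjoint a a′ = ¬T⇒≡false h
    where
    h : ¬ T ((a ≡ᵇ a′) ∧ wheelAdjℕ a a′)
    h t with Equivalence.to (T-∧ {a ≡ᵇ a′}) t
    ... | (t₁ , t₂) with ≡ᵇ⇒≡ a a′ t₁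
    ... | refl rewrite wheelAdjℕ-irrefl a = t₂

  up-and-down-disjoint : ∀ l l′ → ((suc l ≡ᵇ l′) ∧ (suc l′ ≡ᵇ l)) ≡ false
  up-and-down-disjoint l l′ = ¬T⇒≡false h
    where
    h : ¬ T ((suc l ≡ᵇ l′) ∧ (suc l′ ≡ᵇ l))
    h t with Equivalence.to (T-∧ {suc l ≡ᵇ l′}) t
    ... | (t₁ , t₂) with ≡ᵇ⇒≡ (suc l) l′ t₁ | ≡ᵇ⇒≡ (suc l′) l t₂
    ... | refl | ()

  sum-wheelNbrs : ∀ {a} → a < suc m → (H : ℕ → ℕ) →
    sumℕ (suc m) (λ a′ → [ wheelAdjℕ a a′ ] H a′) ≡ wheelNbrSum a 0 (λ a′ _ → H a′)
  sum-wheelNbrs {zero}  _           H = refl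
  sum-wheelNbrs {suc r} (s≤s r<m) H = cong (H 0 +_) (begin
    sumℕ m (λ r′ → [ cycAdj m r r′ ] H (suc r′))
      ≡⟨ sumℕ-cong m (λ r′ r′<m → cycAdj-split r<m r′<m (H ∘ suc)) ⟩
    sumℕ m (λ r′ → ([ next r ≡ᵇ r′ ] H (suc r′)) + ([ prev r ≡ᵇ r′ ] H (suc r′)))
      ≡⟨ sumℕ-+ m (λ r′ → [ next r ≡ᵇ r′ ] H (suc r′)) (λ r′ → [ prev r ≡ᵇ r′ ] H (suc r′)) ⟩
    sumℕ m (λ r′ → [ next r ≡ᵇ r′ ] H (suc r′))
      + sumℕ m (λ r′ → [ prev r ≡ᵇ r′ ] H (suc r′))
      ≡⟨ cong₂ _+_ (sumℕ-indicator m (next r) (H ∘ suc)) (sumℕ-indicator m (prev r) (H ∘ suc)) ⟩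
    ([ next r <ᵇ m ] H (suc (next r))) + ([ prev r <ᵇ m ] H (suc (prev r)))
      ≡⟨ cong₂ (λ b c → ([ b ] H (suc (next r))) + ([ c ] H (suc (prev r))))
               (<ᵇ-true (next<m r<m)) (<ᵇ-true (prev<m r<m)) ⟩
    H (suc (next r)) + H (suc (prev r)) ∎)
    where open ≡-Reasoning

  module _ {a l} (a<1+m : a < suc m) (l<n : l < n) (E : ℕ → ℕ → ℕ) where

    sum-pathNbrs : sumℕ (suc m) (λ a′ → sumℕ n (λ l′ →
                     [ a ≡ᵇ a′ ] ([ pathAdjℕ l l′ ] E a′ l′)))
                   ≡ pathNbrSum a l E
    sum-pathNbrs = begin
      sumℕ (suc m) (λ a′ → sumℕ n (λ l′ → [ a ≡ᵇ a′ ] ([ pathAdjℕ l l′ ] E a′ l′)))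
        ≡⟨ sumℕ-cong (suc m) (λ a′ _ →
             sumℕ-pull-indicator n (a ≡ᵇ a′) (λ l′ → [ pathAdjℕ l l′ ] E a′ l′)) ⟩
      sumℕ (suc m) (λ a′ → [ a ≡ᵇ a′ ] sumℕ n (λ l′ → [ pathAdjℕ l l′ ] E a′ l′))
        ≡⟨ sumℕ-indicator (suc m) a (λ a′ → sumℕ n (λ l′ → [ pathAdjℕ l l′ ] E a′ l′)) ⟩
      ([ a <ᵇ suc m ] sumℕ n (λ l′ → [ pathAdjℕ l l′ ] E a l′))
        ≡⟨ cong (λ b → [ b ] sumℕ n (λ l′ → [ pathAdjℕ l l′ ] E a l′))
                (<ᵇ-true a<1+m) ⟩
      sumℕ n (λ l′ → [ pathAdjℕ l l′ ] E a l′)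
        ≡⟨ sumℕ-cong n (λ l′ _ →
             indicator-∨ (suc l ≡ᵇ l′) (suc l′ ≡ᵇ l) (E a l′) (up-and-down-disjoint l l′)) ⟩
      sumℕ n (λ l′ → ([ suc l ≡ᵇ l′ ] E a l′) + ([ suc l′ ≡ᵇ l ] E a l′))
        ≡⟨ sumℕ-+ n (λ l′ → [ suc l ≡ᵇ l′ ] E a l′) (λ l′ → [ suc l′ ≡ᵇ l ] E a l′) ⟩
      sumℕ n (λ l′ → [ suc l ≡ᵇ l′ ] E a l′) + sumℕ n (λ l′ → [ suc l′ ≡ᵇ l ] E a l′)
        ≡⟨ cong₂ _+_ (sumℕ-indicator n (suc l) (E a)) (sumℕ-indicator-suc n l (E a)) ⟩
      pathNbrSum a l E ∎
      where open ≡-Reasoning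

    sum-wheelNbrs-in-layer : sumℕ (suc m) (λ a′ → sumℕ n (λ l′ →
                               [ wheelAdjℕ a a′ ] ([ l ≡ᵇ l′ ] E a′ l′)))
                             ≡ wheelNbrSum a l E
    sum-wheelNbrs-in-layer = begin
      sumℕ (suc m) (λ a′ → sumℕ n (λ l′ → [ wheelAdjℕ a a′ ] ([ l ≡ᵇ l′ ] E a′ l′)))
        ≡⟨ sumℕ-cong (suc m) (λ a′ _ →
             sumℕ-pull-indicator n (wheelAdjℕ a a′) (λ l′ → [ l ≡ᵇ l′ ] E a′ l′)) ⟩
      sumℕ (suc m) (λ a′ → [ wheelAdjℕ a a′ ] sumℕ n (λ l′ → [ l ≡ᵇ l′ ] E a′ l′))
        ≡⟨ sumℕ-cong (suc m) (λ a′ _ → cong (λ t → [ wheelAdjℕ a a′ ] t)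
             (trans (sumℕ-indicator n l (E a′)) (cong (λ b → [ b ] E a′ l) (<ᵇ-true l<n)))) ⟩
      sumℕ (suc m) (λ a′ → [ wheelAdjℕ a a′ ] E a′ l)
        ≡⟨ sum-wheelNbrs a<1+m (λ a′ → E a′ l) ⟩
      wheelNbrSum a 0 (λ a′ _ → E a′ l)
        ≡⟨ layer-irrelevant a ⟩
      wheelNbrSum a l E ∎
      where
      open ≡-Reasoning
      layer-irrelevant : ∀ a → wheelNbrSum a 0 (λ a′ _ → E a′ l) ≡ wheelNbrSum a l E
      layer-irrelevant zero    = refl
      layer-irrelevant (suc r) = refl

    sum-nbrs : sumℕ (suc m) (λ a′ → sumℕ n (λ l′ → [ adjℕ a l a′ l′ ] E a′ l′))
               ≡ nbrSum a l E
    sum-nbrs = begin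
      sumℕ (suc m) (λ a′ → sumℕ n (λ l′ → [ adjℕ a l a′ l′ ] E a′ l′))
        ≡⟨ sumℕ-cong (suc m) (λ a′ _ → sumℕ-cong n (λ l′ _ →
             indicator-∧∨∧ (a ≡ᵇ a′) (pathAdjℕ l l′) (wheelAdjℕ a a′) (l ≡ᵇ l′) (E a′ l′)
                    (wheel-and-path-disjoint a a′))) ⟩
      sumℕ (suc m) (λ a′ → sumℕ n (λ l′ → P a′ l′ + W a′ l′))
        ≡⟨ sumℕ-cong (suc m) (λ a′ _ → sumℕ-+ n (P a′) (W a′)) ⟩
      sumℕ (suc m) (λ a′ → sumℕ n (P a′) + sumℕ n (W a′))
        ≡⟨ sumℕ-+ (suc m) (λ a′ → sumℕ n (P a′)) (λ a′ → sumℕ n (W a′)) ⟩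
      sumℕ (suc m) (λ a′ → sumℕ n (P a′)) + sumℕ (suc m) (λ a′ → sumℕ n (W a′))
        ≡⟨ cong₂ _+_ sum-pathNbrs sum-wheelNbrs-in-layer ⟩
      nbrSum a l E ∎
      where
      open ≡-Reasoning
      P W : ℕ → ℕ → ℕ
      P a′ l′ = [ a ≡ᵇ a′ ] ([ pathAdjℕ l l′ ] E a′ l′)
      W a′ l′ = [ wheelAdjℕ a a′ ] ([ l ≡ᵇ l′ ] E a′ l′)

  sum-over-nbrs : ∀ x (E : ℕ → ℕ → ℕ) →
    sum (map (λ w → [ adj G x w ] E (column w) (layer w)) (allFin (V G)))
      ≡ nbrSum (column x) (layer x) E
  sum-over-nbrs x E = begin
    sum (map (λ w → [ adj G x w ] E (column w) (layer w)) (allFin (V G)))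
      ≡⟨ sum-map-allFin (V G) _ ⟩
    sumFin (V G) (λ w → [ adj G x w ] E (column w) (layer w))
      ≡⟨ sumFin-cong (V G) (λ w → cong (λ b → [ b ] E (column w) (layer w)) (adj≡adjℕ x w)) ⟩
    sumFin (suc m * n) (g ∘ remQuot {suc m} n)
      ≡⟨ sumFin-remQuot (suc m) n g ⟩
    sumFin (suc m) (λ i → sumFin n (λ j → g (i , j)))
      ≡⟨ sumFin-cong (suc m) (λ i → sumFin-toℕ n (F (toℕ i))) ⟩
    sumFin (suc m) (λ i → sumℕ n (F (toℕ i)))
      ≡⟨ sumFin-toℕ (suc m) (λ a′ → sumℕ n (F a′)) ⟩
    sumℕ (suc m) (λ a′ → sumℕ n (F a′))
      ≡⟨ sum-nbrs (column<1+m x) (layer<n x) E ⟩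
    nbrSum (column x) (layer x) E ∎
    where
    open ≡-Reasoning
    F : ℕ → ℕ → ℕ
    F a′ l′ = [ adjℕ (column x) (layer x) a′ l′ ] E a′ l′
    g : Fin (suc m) × Fin n → ℕ
    g (i , j) = F (toℕ i) (toℕ j)

-- Colours of a total colouring of W_m □ P_n given layer by layer (layers indexed by I):
-- in layer j, the centre, the rim vertex r, the spoke to r and the rim edge from r to
-- next r; between layers j and j + 1, the rung at the centre and the rung at r.
record Palette (I : Set) : Set where
  field
    centre     : I → ℕ
    rim        : I → ℕ → ℕ
    spoke      : I → ℕ → ℕ
    rimEdge    : I → ℕ → ℕ
    centreRung : I → ℕ
    rimRung    : I → ℕ → ℕ

reindex : ∀ {I J : Set} → (J → I) → Palette I → Palette J
reindex f C = record
  { centre     = centre ∘ f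
  ; rim        = rim ∘ f
  ; spoke      = spoke ∘ f
  ; rimEdge    = rimEdge ∘ f
  ; centreRung = centreRung ∘ f
  ; rimRung    = rimRung ∘ f }
  where open Palette C

module LayeredColouring (m0 n k : ℕ) where
  open Product m0 n public

  data Edge : ℕ → ℕ → ℕ → ℕ → Set where
    up       : ∀ a l → Edge a l a (suc l)
    down     : ∀ a l → Edge a (suc l) a l
    spokeOut : ∀ l {r} → r < m → Edge 0 l (suc r) l
    spokeIn  : ∀ l {r} → r < m → Edge (suc r) l 0 l
    rimNext  : ∀ l {r} → r < m → Edge (suc r) l (suc (next r)) l
    rimPrev  : ∀ l {r} → r < m → Edge (suc r) l (suc (prev r)) l

  adjℕ⇒Edge : ∀ {a l a′ l′} → a < suc m → a′ < suc m → T (adjℕ a l a′ l′) → Edge a l a′ l′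
  adjℕ⇒Edge {a} {l} {a′} {l′} a<1+m a′<1+m t
    with Equivalence.to (T-∨ {(a ≡ᵇ a′) ∧ pathAdjℕ l l′}) t
  ... | inj₁ t₁ with Equivalence.to (T-∧ {a ≡ᵇ a′}) t₁
  ...   | (e₁ , e₂) with ≡ᵇ⇒≡ a a′ e₁ | Equivalence.to (T-∨ {suc l ≡ᵇ l′}) e₂
  ...     | refl | inj₁ e₃ with ≡ᵇ⇒≡ (suc l) l′ e₃
  ...       | refl = up a l
  adjℕ⇒Edge {a} {l} {a′} {l′} a<1+m a′<1+m t | inj₁ t₁ | (e₁ , e₂) | refl | inj₂ e₃
    with ≡ᵇ⇒≡ (suc l′) l e₃
  ...       | refl = down a l′
  adjℕ⇒Edge {a} {l} {a′} {l′} a<1+m a′<1+m t | inj₂ t₂ with Equivalence.to (T-∧ {wheelAdjℕ a a′}) t₂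
  ... | (e₁ , e₂) with ≡ᵇ⇒≡ l l′ e₂
  ... | refl = wheelEdge a<1+m a′<1+m e₁
    where
    wheelEdge : ∀ {a a′} → a < suc m → a′ < suc m → T (wheelAdjℕ a a′) → Edge a l a′ l
    wheelEdge {zero}  {suc r}  _           (s≤s r<m)  _ = spokeOut l r<m
    wheelEdge {suc r} {zero}   (s≤s r<m)   _          _ = spokeIn l r<m
    wheelEdge {suc r} {suc r′} (s≤s r<m) (s≤s r′<m) t with cycAdj⇒next⊎prev r<m r′<m t
    ... | inj₁ refl = rimNext l r<m
    ... | inj₂ refl = rimPrev l r<m

  adj⇒Edge : ∀ {x y} → Adj G x y → Edge (column x) (layer x) (column y) (layer y)
  adj⇒Edge {x} {y} t = adjℕ⇒Edge (column<1+m x) (column<1+m y) (subst T (adj≡adjℕ x y) t)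

  IsColour : ℕ → Set
  IsColour x = 1 ≤ x × x ≤ k

  module Colouring (C : Palette ℕ) where
    open Palette C

    vertexColour : ℕ → ℕ → ℕ
    vertexColour zero    l = centre l
    vertexColour (suc r) l = rim l r

    -- The rim edge between r and next r gets rimEdge l r, seen from either end.
    wheelEdgeColour : ℕ → ℕ → ℕ → ℕ
    wheelEdgeColour l zero    zero     = 0
    wheelEdgeColour l zero    (suc r)  = spoke l r
    wheelEdgeColour l (suc r) zero     = spoke l r
    wheelEdgeColour l (suc r) (suc r′) = if r′ ≡ᵇ next r then rimEdge l r else rimEdge l r′

    rungColour : ℕ → ℕ → ℕ
    rungColour l zero    = centreRung l
    rungColour l (suc r) = rimRung l r

    edgeColour : ℕ → ℕ → ℕ → ℕ → ℕ
    edgeColour a l a′ l′ = if l ≡ᵇ l′ then wheelEdgeColour l a a′ else rungColour (l ⊓ l′) a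

    colouring : TotalColouring G
    colouring = record
      { cv = λ x → vertexColour (column x) (layer x)
      ; ce = λ x y → edgeColour (column x) (layer x) (column y) (layer y) }

    upRung : ℕ → ℕ → ℕ
    upRung a l = [ suc l <ᵇ n ] rungColour l a

    downRung : ℕ → ℕ → ℕ
    downRung a zero    = 0
    downRung a (suc l) = rungColour l a

    wheelEdgeSum : ℕ → ℕ → ℕ
    wheelEdgeSum zero    l = sumℕ m (spoke l)
    wheelEdgeSum (suc r) l = spoke l r + (rimEdge l r + rimEdge l (prev r))

    weightℕ : ℕ → ℕ → ℕ
    weightℕ a l = vertexColour a l + ((upRung a l + downRung a l) + wheelEdgeSum a l)

    centreWeight : ℕ → ℕ
    centreWeight j = weightℕ 0 j

    rimWeight : ℕ → ℕ → ℕ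
    rimWeight j r = weightℕ (suc r) j

    edgeColour-up : ∀ a l → edgeColour a l a (suc l) ≡ rungColour l a
    edgeColour-up a l rewrite ≡ᵇ-false l (suc l) (λ ()) | m≤n⇒m⊓n≡m (n≤1+n l) = refl

    edgeColour-down : ∀ a l → edgeColour a (suc l) a l ≡ rungColour l a
    edgeColour-down a l rewrite ≡ᵇ-false (suc l) l (λ ()) | m≥n⇒m⊓n≡n (n≤1+n l) = refl

    edgeColour-spokeOut : ∀ l r → edgeColour 0 l (suc r) l ≡ spoke l r
    edgeColour-spokeOut l r rewrite ≡ᵇ-true l l refl = refl

    edgeColour-spokeIn : ∀ l r → edgeColour (suc r) l 0 l ≡ spoke l r
    edgeColour-spokeIn l r rewrite ≡ᵇ-true l l refl = refl

    edgeColour-rimNext : ∀ l r → edgeColour (suc r) l (suc (next r)) l ≡ rimEdge l r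
    edgeColour-rimNext l r rewrite ≡ᵇ-true l l refl | ≡ᵇ-true (next r) (next r) refl = refl

    edgeColour-rimPrev : ∀ l {r} → r < m → edgeColour (suc r) l (suc (prev r)) l ≡ rimEdge l (prev r)
    edgeColour-rimPrev l {r} r<m
      rewrite ≡ᵇ-true l l refl | ≡ᵇ-false (prev r) (next r) (next≢prev r<m ∘ sym) = refl

    weight≡weightℕ : ∀ x → weight G colouring x ≡ weightℕ (column x) (layer x)
    weight≡weightℕ x = cong (vertexColour (column x) (layer x) +_)
      (trans (sum-over-nbrs x (edgeColour (column x) (layer x)))
             (cong₂ _+_ (pathPart (column x) (layer<n x)) (wheelPart (column<1+m x))))
      where
      pathPart : ∀ a {l} → l < n → pathNbrSum a l (edgeColour a l) ≡ upRung a l + downRung a l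
      pathPart a {zero}  _   = cong₂ _+_ (cong (λ t → [ 1 <ᵇ n ] t) (edgeColour-up a 0)) refl
      pathPart a {suc l} l<n = cong₂ _+_
        (cong (λ t → [ suc (suc l) <ᵇ n ] t) (edgeColour-up a (suc l)))
        (trans (cong (λ b → [ b ] edgeColour a (suc l) a l) (<ᵇ-true (<-trans (n<1+n l) l<n)))
               (edgeColour-down a l))
      wheelPart : ∀ {a l} → a < suc m → wheelNbrSum a l (edgeColour a l) ≡ wheelEdgeSum a l
      wheelPart {zero}  {l} _         = sumℕ-cong m (λ r _ → edgeColour-spokeOut l r)
      wheelPart {suc r} {l} (s≤s r<m) = cong₂ _+_ (edgeColour-spokeIn l r)
        (cong₂ _+_ (edgeColour-rimNext l r) (edgeColour-rimPrev l r<m))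

    -- One condition for each way two adjacent or incident elements of W_m □ P_n can
    -- meet; '↑' refers to layer j + 1.
    record Admissible : Set where
      field
        centre-range           : ∀ j → j < n → IsColour (centre j)
        rim-range              : ∀ j r → j < n → r < m → IsColour (rim j r)
        spoke-range            : ∀ j r → j < n → r < m → IsColour (spoke j r)
        rimEdge-range          : ∀ j r → j < n → r < m → IsColour (rimEdge j r)
        centreRung-range       : ∀ j → suc j < n → IsColour (centreRung j)
        rimRung-range          : ∀ j r → suc j < n → r < m → IsColour (rimRung j r)
        centre≢centre↑         : ∀ j → suc j < n → centre j ≢ centre (suc j)
        rim≢rim↑               : ∀ j r → suc j < n → r < m → rim j r ≢ rim (suc j) r
        centre≢rim             : ∀ j r → j < n → r < m → centre j ≢ rim j r
        rim≢rim-next           : ∀ j r → j < n → r < m → rim j r ≢ rim j (next r)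
        centreRung≢centreRung↑ : ∀ j → suc (suc j) < n → centreRung j ≢ centreRung (suc j)
        centreRung≢spoke       : ∀ j r → suc j < n → r < m → centreRung j ≢ spoke j r
        centreRung≢spoke↑      : ∀ j r → suc j < n → r < m → centreRung j ≢ spoke (suc j) r
        spoke-injective        : ∀ j r r′ → j < n → r < m → r′ < m → r ≢ r′ → spoke j r ≢ spoke j r′
        rimRung≢rimRung↑       : ∀ j r → suc (suc j) < n → r < m → rimRung j r ≢ rimRung (suc j) r
        rimRung≢spoke          : ∀ j r → suc j < n → r < m → rimRung j r ≢ spoke j r
        rimRung≢rimEdge        : ∀ j r → suc j < n → r < m → rimRung j r ≢ rimEdge j r
        rimRung≢rimEdge-prev   : ∀ j r → suc j < n → r < m → rimRung j r ≢ rimEdge j (prev r)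
        rimRung≢spoke↑         : ∀ j r → suc j < n → r < m → rimRung j r ≢ spoke (suc j) r
        rimRung≢rimEdge↑       : ∀ j r → suc j < n → r < m → rimRung j r ≢ rimEdge (suc j) r
        rimRung≢rimEdge-prev↑  : ∀ j r → suc j < n → r < m → rimRung j r ≢ rimEdge (suc j) (prev r)
        spoke≢rimEdge          : ∀ j r → j < n → r < m → spoke j r ≢ rimEdge j r
        spoke≢rimEdge-prev     : ∀ j r → j < n → r < m → spoke j r ≢ rimEdge j (prev r)
        rimEdge≢rimEdge-prev   : ∀ j r → j < n → r < m → rimEdge j r ≢ rimEdge j (prev r)
        centreRung≢centre      : ∀ j → suc j < n → centreRung j ≢ centre j
        rimRung≢rim            : ∀ j r → suc j < n → r < m → rimRung j r ≢ rim j r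
        centreRung≢centre↑     : ∀ j → suc j < n → centreRung j ≢ centre (suc j)
        rimRung≢rim↑           : ∀ j r → suc j < n → r < m → rimRung j r ≢ rim (suc j) r
        spoke≢centre           : ∀ j r → j < n → r < m → spoke j r ≢ centre j
        spoke≢rim              : ∀ j r → j < n → r < m → spoke j r ≢ rim j r
        rimEdge≢rim            : ∀ j r → j < n → r < m → rimEdge j r ≢ rim j r
        rimEdge≢rim-next       : ∀ j r → j < n → r < m → rimEdge j r ≢ rim j (next r)
        weight-centre≢rim      : ∀ j r → j < n → r < m → centreWeight j ≢ rimWeight j r
        weight-rim≢rim-next    : ∀ j r → j < n → r < m → rimWeight j r ≢ rimWeight j (next r)
        weight-centre≢centre↑  : ∀ j → suc j < n → centreWeight j ≢ centreWeight (suc j)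
        weight-rim≢rim↑        : ∀ j r → suc j < n → r < m → rimWeight j r ≢ rimWeight (suc j) r

    module _ (ok : Admissible) where
      open Admissible ok

      vertexColour-range : ∀ {a l} → a < suc m → l < n → IsColour (vertexColour a l)
      vertexColour-range {zero}  {l} _   l<n = centre-range l l<n
      vertexColour-range {suc r} {l} a<1+m l<n = rim-range l r l<n (s<s⁻¹ a<1+m)

      edgeColour-range : ∀ {a l a′ l′} → a < suc m → l < n → l′ < n → Edge a l a′ l′ →
                         IsColour (edgeColour a l a′ l′)
      edgeColour-range _ _ l′<n (up zero l) rewrite edgeColour-up 0 l = centreRung-range l l′<n
      edgeColour-range a<1+m _ l′<n (up (suc r) l) rewrite edgeColour-up (suc r) l =
        rimRung-range l r l′<n (s<s⁻¹ a<1+m)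
      edgeColour-range _ l<n _ (down zero l) rewrite edgeColour-down 0 l = centreRung-range l l<n
      edgeColour-range a<1+m l<n _ (down (suc r) l) rewrite edgeColour-down (suc r) l =
        rimRung-range l r l<n (s<s⁻¹ a<1+m)
      edgeColour-range _ l<n _ (spokeOut l {r} r<m) rewrite edgeColour-spokeOut l r = spoke-range l r l<n r<m
      edgeColour-range _ l<n _ (spokeIn l {r} r<m) rewrite edgeColour-spokeIn l r = spoke-range l r l<n r<m
      edgeColour-range _ l<n _ (rimNext l {r} r<m) rewrite edgeColour-rimNext l r = rimEdge-range l r l<n r<m
      edgeColour-range _ l<n _ (rimPrev l {r} r<m) rewrite edgeColour-rimPrev l r<m =
        rimEdge-range l (prev r) l<n (prev<m r<m)

      edgeColour-sym : ∀ {a l a′ l′} → Edge a l a′ l′ → edgeColour a l a′ l′ ≡ edgeColour a′ l′ a l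
      edgeColour-sym (up a l)   rewrite edgeColour-up a l | edgeColour-down a l = refl
      edgeColour-sym (down a l) rewrite edgeColour-up a l | edgeColour-down a l = refl
      edgeColour-sym (spokeOut l {r} _) rewrite edgeColour-spokeOut l r | edgeColour-spokeIn l r = refl
      edgeColour-sym (spokeIn l {r} _)  rewrite edgeColour-spokeOut l r | edgeColour-spokeIn l r = refl
      edgeColour-sym (rimNext l {r} r<m) rewrite edgeColour-rimNext l r = sym (begin
        edgeColour (suc (next r)) l (suc r) l
          ≡⟨ cong (λ t → edgeColour (suc (next r)) l (suc t) l) (sym (prev-next r<m)) ⟩
        edgeColour (suc (next r)) l (suc (prev (next r))) l
          ≡⟨ edgeColour-rimPrev l (next<m r<m) ⟩
        rimEdge l (prev (next r))
          ≡⟨ cong (rimEdge l) (prev-next r<m) ⟩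
        rimEdge l r ∎)
        where open ≡-Reasoning
      edgeColour-sym (rimPrev l {r} r<m) rewrite edgeColour-rimPrev l r<m = sym (begin
        edgeColour (suc (prev r)) l (suc r) l
          ≡⟨ cong (λ t → edgeColour (suc (prev r)) l (suc t) l) (sym (next-prev r<m)) ⟩
        edgeColour (suc (prev r)) l (suc (next (prev r))) l
          ≡⟨ edgeColour-rimNext l (prev r) ⟩
        rimEdge l (prev r) ∎)
        where open ≡-Reasoning

      vertexColour-proper : ∀ {a l a′ l′} → a < suc m → l < n → l′ < n → Edge a l a′ l′ →
                            vertexColour a l ≢ vertexColour a′ l′
      vertexColour-proper _ _ l′<n (up zero l) = centre≢centre↑ l l′<n
      vertexColour-proper a<1+m _ l′<n (up (suc r) l) = rim≢rim↑ l r l′<n (s<s⁻¹ a<1+m)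
      vertexColour-proper _ l<n _ (down zero l) = centre≢centre↑ l l<n ∘ sym
      vertexColour-proper a<1+m l<n _ (down (suc r) l) = rim≢rim↑ l r l<n (s<s⁻¹ a<1+m) ∘ sym
      vertexColour-proper _ l<n _ (spokeOut l {r} r<m) = centre≢rim l r l<n r<m
      vertexColour-proper _ l<n _ (spokeIn l {r} r<m) = centre≢rim l r l<n r<m ∘ sym
      vertexColour-proper _ l<n _ (rimNext l {r} r<m) = rim≢rim-next l r l<n r<m
      vertexColour-proper _ l<n _ (rimPrev l {r} r<m) e =
        rim≢rim-next l (prev r) l<n (prev<m r<m) (trans (sym e) (cong (rim l) (sym (next-prev r<m))))

      edgeColour≢vertexColour : ∀ {a l a′ l′} → a < suc m → l < n → l′ < n → Edge a l a′ l′ →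
                                edgeColour a l a′ l′ ≢ vertexColour a l
      edgeColour≢vertexColour _ _ l′<n (up zero l) rewrite edgeColour-up 0 l = centreRung≢centre l l′<n
      edgeColour≢vertexColour a<1+m _ l′<n (up (suc r) l) rewrite edgeColour-up (suc r) l =
        rimRung≢rim l r l′<n (s<s⁻¹ a<1+m)
      edgeColour≢vertexColour _ l<n _ (down zero l) rewrite edgeColour-down 0 l = centreRung≢centre↑ l l<n
      edgeColour≢vertexColour a<1+m l<n _ (down (suc r) l) rewrite edgeColour-down (suc r) l =
        rimRung≢rim↑ l r l<n (s<s⁻¹ a<1+m)
      edgeColour≢vertexColour _ l<n _ (spokeOut l {r} r<m) rewrite edgeColour-spokeOut l r =
        spoke≢centre l r l<n r<m
      edgeColour≢vertexColour _ l<n _ (spokeIn l {r} r<m) rewrite edgeColour-spokeIn l r =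
        spoke≢rim l r l<n r<m
      edgeColour≢vertexColour _ l<n _ (rimNext l {r} r<m) rewrite edgeColour-rimNext l r =
        rimEdge≢rim l r l<n r<m
      edgeColour≢vertexColour _ l<n _ (rimPrev l {r} r<m) rewrite edgeColour-rimPrev l r<m = λ e →
        rimEdge≢rim-next l (prev r) l<n (prev<m r<m) (trans e (cong (rim l) (sym (next-prev r<m))))

      weight-proper : ∀ {a l a′ l′} → a < suc m → l < n → l′ < n → Edge a l a′ l′ →
                      weightℕ a l ≢ weightℕ a′ l′
      weight-proper _ _ l′<n (up zero l) = weight-centre≢centre↑ l l′<n
      weight-proper a<1+m _ l′<n (up (suc r) l) = weight-rim≢rim↑ l r l′<n (s<s⁻¹ a<1+m)
      weight-proper _ l<n _ (down zero l) = weight-centre≢centre↑ l l<n ∘ sym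
      weight-proper a<1+m l<n _ (down (suc r) l) = weight-rim≢rim↑ l r l<n (s<s⁻¹ a<1+m) ∘ sym
      weight-proper _ l<n _ (spokeOut l {r} r<m) = weight-centre≢rim l r l<n r<m
      weight-proper _ l<n _ (spokeIn l {r} r<m) = weight-centre≢rim l r l<n r<m ∘ sym
      weight-proper _ l<n _ (rimNext l {r} r<m) = weight-rim≢rim-next l r l<n r<m
      weight-proper _ l<n _ (rimPrev l {r} r<m) e = weight-rim≢rim-next l (prev r) l<n (prev<m r<m)
        (trans (sym e) (cong (rimWeight l) (sym (next-prev r<m))))

      private
        Distinct : ℕ → ℕ → ℕ → ℕ → Set
        Distinct a₁ l₁ a₂ l₂ = ¬ (a₁ ≡ a₂ × l₁ ≡ l₂)

      edgeColour-proper-centre : ∀ {l a₁ l₁ a₂ l₂} → l < n → l₁ < n → l₂ < n →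
        Edge 0 l a₁ l₁ → Edge 0 l a₂ l₂ → Distinct a₁ l₁ a₂ l₂ → edgeColour 0 l a₁ l₁ ≢ edgeColour 0 l a₂ l₂
      edgeColour-proper-centre _ _ _ (up _ _)   (up _ _)   ne = ⊥-elim (ne (refl , refl))
      edgeColour-proper-centre _ _ _ (down _ _) (down _ _) ne = ⊥-elim (ne (refl , refl))
      edgeColour-proper-centre q _ _ (spokeOut l {r} r<m) (spokeOut .l {r′} r′<m) ne
        rewrite edgeColour-spokeOut l r | edgeColour-spokeOut l r′ =
        spoke-injective l r r′ q r<m r′<m (λ e → ne (cong suc e , refl))
      edgeColour-proper-centre _ q₁ _ (up _ (suc l)) (down _ .l) _
        rewrite edgeColour-up 0 (suc l) | edgeColour-down 0 l = centreRung≢centreRung↑ l q₁ ∘ sym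
      edgeColour-proper-centre _ _ q₂ (down _ l) (up _ .(suc l)) _
        rewrite edgeColour-up 0 (suc l) | edgeColour-down 0 l = centreRung≢centreRung↑ l q₂
      edgeColour-proper-centre _ q₁ _ (up _ l) (spokeOut .l {r} r<m) _
        rewrite edgeColour-up 0 l | edgeColour-spokeOut l r = centreRung≢spoke l r q₁ r<m
      edgeColour-proper-centre _ _ q₂ (spokeOut l {r} r<m) (up _ .l) _
        rewrite edgeColour-up 0 l | edgeColour-spokeOut l r = centreRung≢spoke l r q₂ r<m ∘ sym
      edgeColour-proper-centre q _ _ (down _ l) (spokeOut .(suc l) {r} r<m) _
        rewrite edgeColour-down 0 l | edgeColour-spokeOut (suc l) r = centreRung≢spoke↑ l r q r<m
      edgeColour-proper-centre q _ _ (spokeOut .(suc l) {r} r<m) (down _ l) _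
        rewrite edgeColour-down 0 l | edgeColour-spokeOut (suc l) r = centreRung≢spoke↑ l r q r<m ∘ sym

      edgeColour-proper-rim : ∀ {r l a₁ l₁ a₂ l₂} → r < m → l < n → l₁ < n → l₂ < n →
        Edge (suc r) l a₁ l₁ → Edge (suc r) l a₂ l₂ → Distinct a₁ l₁ a₂ l₂ →
        edgeColour (suc r) l a₁ l₁ ≢ edgeColour (suc r) l a₂ l₂
      edgeColour-proper-rim _ _ _ _ (up _ _)      (up _ _)      ne = ⊥-elim (ne (refl , refl))
      edgeColour-proper-rim _ _ _ _ (down _ _)    (down _ _)    ne = ⊥-elim (ne (refl , refl))
      edgeColour-proper-rim _ _ _ _ (spokeIn _ _) (spokeIn _ _) ne = ⊥-elim (ne (refl , refl))
      edgeColour-proper-rim _ _ _ _ (rimNext _ _) (rimNext _ _) ne = ⊥-elim (ne (refl , refl))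
      edgeColour-proper-rim _ _ _ _ (rimPrev _ _) (rimPrev _ _) ne = ⊥-elim (ne (refl , refl))
      edgeColour-proper-rim {r} r<m _ q₁ _ (up _ (suc l)) (down _ .l) _
        rewrite edgeColour-up (suc r) (suc l) | edgeColour-down (suc r) l = rimRung≢rimRung↑ l r q₁ r<m ∘ sym
      edgeColour-proper-rim {r} r<m _ _ q₂ (down _ l) (up _ .(suc l)) _
        rewrite edgeColour-up (suc r) (suc l) | edgeColour-down (suc r) l = rimRung≢rimRung↑ l r q₂ r<m
      edgeColour-proper-rim {r} r<m _ q₁ _ (up _ l) (spokeIn .l _) _
        rewrite edgeColour-up (suc r) l | edgeColour-spokeIn l r = rimRung≢spoke l r q₁ r<m
      edgeColour-proper-rim {r} r<m _ _ q₂ (spokeIn l _) (up _ .l) _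
        rewrite edgeColour-up (suc r) l | edgeColour-spokeIn l r = rimRung≢spoke l r q₂ r<m ∘ sym
      edgeColour-proper-rim {r} r<m _ q₁ _ (up _ l) (rimNext .l _) _
        rewrite edgeColour-up (suc r) l | edgeColour-rimNext l r = rimRung≢rimEdge l r q₁ r<m
      edgeColour-proper-rim {r} r<m _ _ q₂ (rimNext l _) (up _ .l) _
        rewrite edgeColour-up (suc r) l | edgeColour-rimNext l r = rimRung≢rimEdge l r q₂ r<m ∘ sym
      edgeColour-proper-rim {r} r<m _ q₁ _ (up _ l) (rimPrev .l _) _
        rewrite edgeColour-up (suc r) l | edgeColour-rimPrev l r<m = rimRung≢rimEdge-prev l r q₁ r<m
      edgeColour-proper-rim {r} r<m _ _ q₂ (rimPrev l _) (up _ .l) _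
        rewrite edgeColour-up (suc r) l | edgeColour-rimPrev l r<m = rimRung≢rimEdge-prev l r q₂ r<m ∘ sym
      edgeColour-proper-rim {r} r<m q _ _ (down _ l) (spokeIn .(suc l) _) _
        rewrite edgeColour-down (suc r) l | edgeColour-spokeIn (suc l) r = rimRung≢spoke↑ l r q r<m
      edgeColour-proper-rim {r} r<m q _ _ (spokeIn .(suc l) _) (down _ l) _
        rewrite edgeColour-down (suc r) l | edgeColour-spokeIn (suc l) r = rimRung≢spoke↑ l r q r<m ∘ sym
      edgeColour-proper-rim {r} r<m q _ _ (down _ l) (rimNext .(suc l) _) _
        rewrite edgeColour-down (suc r) l | edgeColour-rimNext (suc l) r = rimRung≢rimEdge↑ l r q r<m
      edgeColour-proper-rim {r} r<m q _ _ (rimNext .(suc l) _) (down _ l) _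
        rewrite edgeColour-down (suc r) l | edgeColour-rimNext (suc l) r = rimRung≢rimEdge↑ l r q r<m ∘ sym
      edgeColour-proper-rim {r} r<m q _ _ (down _ l) (rimPrev .(suc l) _) _
        rewrite edgeColour-down (suc r) l | edgeColour-rimPrev (suc l) r<m = rimRung≢rimEdge-prev↑ l r q r<m
      edgeColour-proper-rim {r} r<m q _ _ (rimPrev .(suc l) _) (down _ l) _
        rewrite edgeColour-down (suc r) l | edgeColour-rimPrev (suc l) r<m = rimRung≢rimEdge-prev↑ l r q r<m ∘ sym
      edgeColour-proper-rim {r} r<m q _ _ (spokeIn l _) (rimNext .l _) _
        rewrite edgeColour-spokeIn l r | edgeColour-rimNext l r = spoke≢rimEdge l r q r<m
      edgeColour-proper-rim {r} r<m q _ _ (rimNext l _) (spokeIn .l _) _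
        rewrite edgeColour-spokeIn l r | edgeColour-rimNext l r = spoke≢rimEdge l r q r<m ∘ sym
      edgeColour-proper-rim {r} r<m q _ _ (spokeIn l _) (rimPrev .l _) _
        rewrite edgeColour-spokeIn l r | edgeColour-rimPrev l r<m = spoke≢rimEdge-prev l r q r<m
      edgeColour-proper-rim {r} r<m q _ _ (rimPrev l _) (spokeIn .l _) _
        rewrite edgeColour-spokeIn l r | edgeColour-rimPrev l r<m = spoke≢rimEdge-prev l r q r<m ∘ sym
      edgeColour-proper-rim {r} r<m q _ _ (rimNext l _) (rimPrev .l _) _
        rewrite edgeColour-rimNext l r | edgeColour-rimPrev l r<m = rimEdge≢rimEdge-prev l r q r<m
      edgeColour-proper-rim {r} r<m q _ _ (rimPrev l _) (rimNext .l _) _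
        rewrite edgeColour-rimNext l r | edgeColour-rimPrev l r<m = rimEdge≢rimEdge-prev l r q r<m ∘ sym

      edgeColour-proper : ∀ {a l a₁ l₁ a₂ l₂} → a < suc m → l < n → l₁ < n → l₂ < n →
        Edge a l a₁ l₁ → Edge a l a₂ l₂ → Distinct a₁ l₁ a₂ l₂ → edgeColour a l a₁ l₁ ≢ edgeColour a l a₂ l₂
      edgeColour-proper {zero}  _     = edgeColour-proper-centre
      edgeColour-proper {suc r} a<1+m = edgeColour-proper-rim (s<s⁻¹ a<1+m)

      isSumDistTotal : IsSumDistTotal G k colouring
      isSumDistTotal =
          (λ v → vertexColour-range (column<1+m v) (layer<n v))
        , (λ u v t → edgeColour-range (column<1+m u) (layer<n u) (layer<n v) (adj⇒Edge t))
        , (λ u v t → edgeColour-sym (adj⇒Edge t))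
        , (λ u v t → vertexColour-proper (column<1+m u) (layer<n u) (layer<n v) (adj⇒Edge t))
        , (λ u v w t₁ t₂ v≢w → edgeColour-proper (column<1+m u) (layer<n u) (layer<n v) (layer<n w)
                                 (adj⇒Edge t₁) (adj⇒Edge t₂) (λ (e₁ , e₂) → v≢w (coords-injective e₁ e₂)))
        , (λ u v t → edgeColour≢vertexColour (column<1+m u) (layer<n u) (layer<n v) (adj⇒Edge t))
        , (λ u v t e → weight-proper (column<1+m u) (layer<n u) (layer<n v) (adj⇒Edge t)
                         (trans (sym (weight≡weightℕ u)) (trans e (weight≡weightℕ v))))

    hasSumDistTotal : Admissible → HasSumDistTotal G k
    hasSumDistTotal ok = colouring , isSumDistTotal ok

triangle : ℕ → ℕ
triangle zero    = 0
triangle (suc j) = suc j + triangle j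

InRange : ℕ → ℕ → Set
InRange j c = 1 ≤ c × c ≤ j

-- Induction on j, removing the colour j when it occurs.
module _ where
  private
    occurs : ℕ → List ℕ → Bool
    occurs x []       = false
    occurs x (c ∷ cs) = (c ≡ᵇ x) ∨ occurs x cs

    remove : ℕ → List ℕ → List ℕ
    remove x []       = []
    remove x (c ∷ cs) = if c ≡ᵇ x then cs else c ∷ remove x cs

    remove-occurring : ∀ x cs → T (occurs x cs) →
      length cs ≡ suc (length (remove x cs)) × sum cs ≡ x + sum (remove x cs)
    remove-occurring x (c ∷ cs) t with c ≡ᵇ x in eq
    ... | true  rewrite ≡ᵇ⇒≡ c x (subst T (sym eq) tt) = refl , refl
    ... | false with remove-occurring x cs t
    ...   | (e₁ , e₂) = cong suc e₁ , trans (cong (c +_) e₂) (x+y+z≡y+x+z c x (sum (remove x cs)))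
      where
      x+y+z≡y+x+z : ∀ a b c → a + (b + c) ≡ b + (a + c)
      x+y+z≡y+x+z = solve-∀

    absent : ∀ x cs → ¬ T (occurs x cs) → All (_≢ x) cs
    absent x []       _ = []
    absent x (c ∷ cs) h with c ≡ᵇ x in eq
    ... | true  = ⊥-elim (h tt)
    ... | false = (λ e → subst T eq (≡⇒≡ᵇ c x e)) ∷ absent x cs h

    All-remove : ∀ {P : ℕ → Set} x {cs} → All P cs → All P (remove x cs)
    All-remove x {[]}     []       = []
    All-remove x {c ∷ cs} (p ∷ ps) with c ≡ᵇ x
    ... | true  = ps
    ... | false = p ∷ All-remove x ps

    unique-remove : ∀ x {cs} → Unique cs → Unique (remove x cs)
    unique-remove x {[]}     []       = []
    unique-remove x {c ∷ cs} (p ∷ ps) with c ≡ᵇ x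
    ... | true  = ps
    ... | false = All-remove x p ∷ unique-remove x ps

    removed-absent : ∀ x {cs} → Unique cs → All (_≢ x) (remove x cs)
    removed-absent x {[]}     []       = []
    removed-absent x {c ∷ cs} (p ∷ ps) with c ≡ᵇ x in eq
    ... | true  = All.map (λ c≢d d≡x → c≢d (trans (≡ᵇ⇒≡ c x (subst T (sym eq) tt)) (sym d≡x))) p
    ... | false = (λ e → subst T eq (≡⇒≡ᵇ c x e)) ∷ removed-absent x ps

    shrink : ∀ j {cs} → All (InRange (suc j)) cs → All (_≢ suc j) cs → All (InRange j) cs
    shrink j []              []          = []
    shrink j ((1≤c , c≤) ∷ ps) (c≢ ∷ c≢s) = (1≤c , s≤s⁻¹ (≤∧≢⇒< c≤ c≢)) ∷ shrink j ps c≢s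

  unique-in-range : ∀ j cs → Unique cs → All (InRange j) cs →
    length cs ≤ j × (length cs ≡ j → sum cs ≡ triangle j)
  unique-in-range zero    []       _ _ = z≤n , λ _ → refl
  unique-in-range zero    (c ∷ cs) _ ((1≤c , c≤0) ∷ _) = ⊥-elim (<-irrefl refl (≤-trans 1≤c c≤0))
  unique-in-range (suc j) cs u a with occurs (suc j) cs in eq
  ... | true with remove-occurring (suc j) cs (subst T (sym eq) tt)
                | unique-in-range j (remove (suc j) cs) (unique-remove (suc j) u)
                    (shrink j (All-remove (suc j) a) (removed-absent (suc j) u))
  ...   | (e₁ , e₂) | (ih₁ , ih₂) = subst (_≤ suc j) (sym e₁) (s≤s ih₁) ,
            λ e → trans e₂ (cong (suc j +_) (ih₂ (suc-injective (trans (sym e₁) e))))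
  unique-in-range (suc j) cs u a | false with unique-in-range j cs u (shrink j a (absent (suc j) cs (subst T eq)))
  ... | (ih₁ , _) = m≤n⇒m≤1+n ih₁ , λ e → ⊥-elim (<-irrefl refl (subst (_≤ j) e ih₁))

module ColoursAt (G : Graph) {j} {c : TotalColouring G} (valid : IsSumDistTotal G j c) (x : Fin (V G)) where

  private
    cv-range : ∀ v → InRange j (cv c v)
    cv-range = proj₁ valid
    ce-range : ∀ u v → Adj G u v → InRange j (ce c u v)
    ce-range = proj₁ (proj₂ valid)
    ce-proper : ∀ u v w → Adj G u v → Adj G u w → v ≢ w → ce c u v ≢ ce c u w
    ce-proper = proj₁ (proj₂ (proj₂ (proj₂ (proj₂ valid))))
    ce≢cv : ∀ u v → Adj G u v → ce c u v ≢ cv c u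
    ce≢cv = proj₁ (proj₂ (proj₂ (proj₂ (proj₂ (proj₂ valid)))))

  nbrs : List (Fin (V G))
  nbrs = filterᵇ (adj G x) (allFin (V G))

  colours : List ℕ
  colours = cv c x ∷ map (ce c x) nbrs

  sum-indicator-adj : ∀ (f : Fin (V G) → ℕ) ws →
    sum (map (λ w → [ adj G x w ] f w) ws) ≡ sum (map f (filterᵇ (adj G x) ws))
  sum-indicator-adj f []       = refl
  sum-indicator-adj f (w ∷ ws) with adj G x w
  ... | true  = cong (f w +_) (sum-indicator-adj f ws)
  ... | false = sum-indicator-adj f ws

  degree≡length-nbrs : degree G x ≡ length nbrs
  degree≡length-nbrs = trans (sum-indicator-adj (λ _ → 1) (allFin (V G))) (sum-ones nbrs)
    where
    sum-ones : ∀ (ws : List (Fin (V G))) → sum (map (λ _ → 1) ws) ≡ length ws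
    sum-ones []       = refl
    sum-ones (_ ∷ ws) = cong suc (sum-ones ws)

  nbrs-adj : All (Adj G x) nbrs
  nbrs-adj = all-filter (T? ∘ adj G x) (allFin (V G))

  colours-unique : Unique colours
  colours-unique = map⁺ (All.map (λ a e → ce≢cv x _ a (sym e)) nbrs-adj)
                 ∷ edges-unique nbrs-adj (filter⁺ (T? ∘ adj G x) (allFin⁺ (V G)))
    where
    edges-unique : ∀ {ws} → All (Adj G x) ws → Unique ws → Unique (map (ce c x) ws)
    edges-unique []           []           = []
    edges-unique {w ∷ _} (a ∷ as) (w≢ ∷ ps) =
      map⁺ (All.zipWith (λ (b , w≢v) → ce-proper x w _ a b w≢v) (as , w≢)) ∷ edges-unique as ps

  colours-range : All (InRange j) colours
  colours-range = cv-range x ∷ map⁺ (All.map (ce-range x _) nbrs-adj)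

  length-colours : length colours ≡ suc (degree G x)
  length-colours = cong suc (trans (length-map (ce c x) nbrs) (sym degree≡length-nbrs))

  degree<colours : suc (degree G x) ≤ j
  degree<colours = subst (_≤ j) length-colours (proj₁ (unique-in-range j colours colours-unique colours-range))

  weight≡triangle : suc (degree G x) ≡ j → weight G c x ≡ triangle j
  weight≡triangle e = trans (cong (cv c x +_) (sum-indicator-adj (ce c x) (allFin (V G))))
    (proj₂ (unique-in-range j colours colours-unique colours-range) (trans length-colours e))

chiSigma-Δ+1 : (G : Graph) (x : Fin (V G)) → degree G x ≡ maxDegree G →
  HasSumDistTotal G (maxDegree G + 1) → ChiSigmaIs G (maxDegree G + 1)
chiSigma-Δ+1 G x dx has = has , λ j j<Δ+1 (_ , valid) →
  <⇒≱ j<Δ+1 (subst (_≤ j) (trans (cong suc dx) (+-comm 1 (maxDegree G))) (ColoursAt.degree<colours G valid x))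

-- With j = Δ + 1 colours both ends of the edge xy would get weight 1 + ⋯ + j.
chiSigma-Δ+2 : (G : Graph) (x y : Fin (V G)) → Adj G x y →
  degree G x ≡ maxDegree G → degree G y ≡ maxDegree G →
  HasSumDistTotal G (maxDegree G + 2) → ChiSigmaIs G (maxDegree G + 2)
chiSigma-Δ+2 G x y xy dx dy has = has , λ j j<Δ+2 (_ , valid) → weight-proper valid
  (trans (ColoursAt.weight≡triangle G valid x (trans (cong suc dx) (Δ+1≡ valid j<Δ+2)))
         (sym (ColoursAt.weight≡triangle G valid y (trans (cong suc dy) (Δ+1≡ valid j<Δ+2)))))
  where
  Δ+1≡ : ∀ {j c} → IsSumDistTotal G j c → j < maxDegree G + 2 → suc (maxDegree G) ≡ j
  Δ+1≡ {j} valid j<Δ+2 = ≤-antisym (subst (_≤ j) (cong suc dx) (ColoursAt.degree<colours G valid x))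
    (s≤s⁻¹ (subst (j <_) (+-comm (maxDegree G) 2) j<Δ+2))
  weight-proper : ∀ {j c} → IsSumDistTotal G j c → weight G c x ≢ weight G c y
  weight-proper valid = proj₂ (proj₂ (proj₂ (proj₂ (proj₂ (proj₂ valid))))) x y xy

maxDegree≡ : (G : Graph) {D : ℕ} (x : Fin (V G)) →
  (∀ y → degree G y ≤ D) → degree G x ≡ D → maxDegree G ≡ D
maxDegree≡ G {D} x bound dx = ≤-antisym (foldr-⊔-lub (allFin (V G)))
  (subst (_≤ maxDegree G) dx (foldr-⊔-ub (allFin (V G)) (∈-allFin x)))
  where
  foldr-⊔-lub : ∀ ys → foldr _⊔_ 0 (map (degree G) ys) ≤ D
  foldr-⊔-lub []       = z≤n
  foldr-⊔-lub (y ∷ ys) = ⊔-lub (bound y) (foldr-⊔-lub ys)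
  foldr-⊔-ub : ∀ {y} ys → y ∈ ys → degree G y ≤ foldr _⊔_ 0 (map (degree G) ys)
  foldr-⊔-ub (y ∷ ys) (here refl) = m≤m⊔n (degree G y) _
  foldr-⊔-ub (y ∷ ys) (there p)   = ≤-trans (foldr-⊔-ub ys p) (m≤n⊔m (degree G y) _)

module Degrees (m0 n : ℕ) where
  open Product m0 n public

  degreeℕ : ℕ → ℕ → ℕ
  degreeℕ a l = nbrSum a l (λ _ _ → 1)

  degree≡degreeℕ : ∀ x → degree G x ≡ degreeℕ (column x) (layer x)
  degree≡degreeℕ x = sum-over-nbrs x (λ _ _ → 1)

  vertex : Fin (suc m) → Fin n → Fin (V G)
  vertex = combine

  column-vertex : ∀ i j → column (vertex i j) ≡ toℕ i
  column-vertex i j = cong (toℕ ∘ proj₁) (remQuot-combine i j)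

  layer-vertex : ∀ i j → layer (vertex i j) ≡ toℕ j
  layer-vertex i j = cong (toℕ ∘ proj₂) (remQuot-combine i j)

  degree-vertex : ∀ i j → degree G (vertex i j) ≡ degreeℕ (toℕ i) (toℕ j)
  degree-vertex i j =
    trans (degree≡degreeℕ (vertex i j)) (cong₂ degreeℕ (column-vertex i j) (layer-vertex i j))

  adj-vertex : ∀ i j i′ j′ → T (adjℕ (toℕ i) (toℕ j) (toℕ i′) (toℕ j′)) → Adj G (vertex i j) (vertex i′ j′)
  adj-vertex i j i′ j′ = subst T (sym (trans (adj≡adjℕ (vertex i j) (vertex i′ j′))
    (cong₂ (λ (a , l) (a′ , l′) → adjℕ a l a′ l′)
           (cong₂ _,_ (column-vertex i j) (layer-vertex i j))
           (cong₂ _,_ (column-vertex i′ j′) (layer-vertex i′ j′)))))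

  pathDegree≤2 : ∀ a l → pathNbrSum a l (λ _ _ → 1) ≤ 2
  pathDegree≤2 a l = +-mono-≤ (if≤1 (suc l <ᵇ n)) (predTerm≤1 l)
    where
    if≤1 : ∀ b → ([ b ] 1) ≤ 1
    if≤1 true  = ≤-refl
    if≤1 false = z≤n
    predTerm≤1 : ∀ l → predTerm n (λ _ → 1) l ≤ 1
    predTerm≤1 zero    = z≤n
    predTerm≤1 (suc l) = if≤1 (l <ᵇ n)

  centre-wheelDegree : ∀ l → wheelNbrSum 0 l (λ _ _ → 1) ≡ m
  centre-wheelDegree l = trans (sumℕ-const m 1) (*-identityʳ m)

  wheelDegree≤m : ∀ a l → wheelNbrSum a l (λ _ _ → 1) ≤ m
  wheelDegree≤m zero    l = ≤-reflexive (centre-wheelDegree l)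
  wheelDegree≤m (suc r) l = s≤s (s≤s (s≤s z≤n))

  degree≤ : ∀ {D} → (∀ a l → a < suc m → l < n → degreeℕ a l ≤ D) → ∀ x → degree G x ≤ D
  degree≤ {D} h x = subst (_≤ D) (sym (degree≡degreeℕ x)) (h (column x) (layer x) (column<1+m x) (layer<n x))

  degree≤2+m : ∀ x → degree G x ≤ 2 + m
  degree≤2+m = degree≤ (λ a l _ _ → +-mono-≤ (pathDegree≤2 a l) (wheelDegree≤m a l))

module Modular (m : ℕ) .{{_ : NonZero m}} where

  infix 4 _≋_
  record _≋_ (a b : ℕ) : Set where
    constructor mod
    field ≋⇒%≡ : a % m ≡ b % m
  open _≋_ public

  ≡⇒≋ : ∀ {a b} → a ≡ b → a ≋ b
  ≡⇒≋ refl = mod refl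

  ≋-trans : ∀ {a b c} → a ≋ b → b ≋ c → a ≋ c
  ≋-trans (mod e₁) (mod e₂) = mod (trans e₁ e₂)

  ≋-sym : ∀ {a b} → a ≋ b → b ≋ a
  ≋-sym (mod e) = mod (sym e)

  ≋-+ : ∀ {a a′ b b′} → a ≋ a′ → b ≋ b′ → a + b ≋ a′ + b′
  ≋-+ {a} {a′} {b} {b′} (mod e₁) (mod e₂) = mod (begin
    (a + b) % m             ≡⟨ %-distribˡ-+ a b m ⟩
    (a % m + b % m) % m     ≡⟨ cong₂ (λ u v → (u + v) % m) e₁ e₂ ⟩
    (a′ % m + b′ % m) % m   ≡⟨ sym (%-distribˡ-+ a′ b′ m) ⟩
    (a′ + b′) % m           ∎)
    where open ≡-Reasoning

  ≋-*ˡ : ∀ c {a b} → a ≋ b → c * a ≋ c * b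
  ≋-*ˡ zero    _ = mod refl
  ≋-*ˡ (suc c) e = ≋-+ e (≋-*ˡ c e)

  ≋-suc : ∀ {a b} → a ≋ b → suc a ≋ suc b
  ≋-suc = ≋-+ {1} {1} (mod refl)

  +m≋ : ∀ a → a + m ≋ a
  +m≋ a = mod ([m+n]%n≡m%n a m)

  σ : ℕ → ℕ
  σ x = suc (x % m)

  σ≋ : ∀ x → σ x ≋ suc x
  σ≋ x = ≋-suc (mod (m%n%n≡m%n x m))

  σ-cong : ∀ {a b} → a ≋ b → σ a ≡ σ b
  σ-cong (mod e) = cong suc e

  1≤σ : ∀ x → 1 ≤ σ x
  1≤σ x = s≤s z≤n

  σ≤m : ∀ x → σ x ≤ m
  σ≤m x = m%n<n x m

  σ-< : ∀ {x} → x < m → σ x ≡ suc x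
  σ-< x<m = cong suc (m<n⇒m%n≡m x<m)

  σ-shift≢ : ∀ x {d} → 0 < d → d < m → σ x ≢ σ (x + d)
  σ-shift≢ x {d} 0<d d<m e = shift≢ (m%n<n x m)
    (trans (sym (≋⇒%≡ (≋-+ (≋-sym (mod (m%n%n≡m%n x m))) (≡⇒≋ {d} refl)))) (sym (suc-injective e)))
    where
    shift≢ : ∀ {y} → y < m → (y + d) % m ≢ y
    shift≢ {y} y<m eq with y + d <? m
    ... | yes y+d<m = <-irrefl refl (subst (y <_) (trans (sym (m<n⇒m%n≡m y+d<m)) eq) (m<m+n y 0<d))
    ... | no  y+d≮m = <-irrefl (+-cancelˡ-≡ y d m y+d≡y+m) d<m
      where
      m≤y+d : m ≤ y + d
      m≤y+d = ≮⇒≥ y+d≮m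
      y+d∸m≡y : y + d ∸ m ≡ y
      y+d∸m≡y = trans (sym (m<n⇒m%n≡m (+-cancelʳ-< m (y + d ∸ m) m
                        (subst (_< m + m) (sym (m∸n+n≡m m≤y+d)) (+-mono-< y<m d<m)))))
                      (trans (m≤n⇒[n∸m]%m≡n%m m≤y+d) eq)
      y+d≡y+m : y + d ≡ y + m
      y+d≡y+m = trans (sym (m∸n+n≡m m≤y+d)) (cong (_+ m) y+d∸m≡y)

even : ℕ → Bool
even zero    = true
even (suc j) = not (even j)

-- For m = 5 + m1: rim vertex r of layer j gets σ (r + offset j), the offsets 3 and m − 1
-- alternating between layers; the rim edge from r gets σ (r + 2) and the spoke to r gets
-- r + 1.  All colours at the centre and on the rungs exceed m, so they never meet the
-- wheel colours, and along the rim the weights go up by 4 (mod m) from r to next r.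
module ModularColouring (m1 n k : ℕ) (centreOf rungOf : ℕ → ℕ) where
  open LayeredColouring (2 + m1) n k
  open Modular m

  offset : ℕ → ℕ
  offset j = if even j then 3 else 4 + m1

  C : Palette ℕ
  C = record
    { centre     = centreOf
    ; rim        = λ j r → σ (r + offset j)
    ; spoke      = λ _ r → suc r
    ; rimEdge    = λ _ r → σ (r + 2)
    ; centreRung = rungOf
    ; rimRung    = λ j _ → rungOf j }

  open Colouring C

  rungSum : ℕ → ℕ
  rungSum j = upRung 0 j + downRung 0 j

  record Requirements : Set where
    field
      m≤k                : m ≤ k
      centreOf-range     : ∀ j → j < n → m < centreOf j × centreOf j ≤ k
      rungOf-range       : ∀ j → suc j < n → m < rungOf j × rungOf j ≤ k
      centreOf≢centreOf↑ : ∀ j → suc j < n → centreOf j ≢ centreOf (suc j)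
      rungOf≢rungOf↑     : ∀ j → suc (suc j) < n → rungOf j ≢ rungOf (suc j)
      rungOf≢centreOf    : ∀ j → suc j < n → rungOf j ≢ centreOf j
      rungOf≢centreOf↑   : ∀ j → suc j < n → rungOf j ≢ centreOf (suc j)
      centre-weights≢    : ∀ j → suc j < n → centreOf j + rungSum j ≢ centreOf (suc j) + rungSum (suc j)
      rungSums-apart     : ∀ j → suc j < n →
        rungSum j ≡ rungSum (suc j) ⊎ rungSum j + m ≤ rungSum (suc j) ⊎ rungSum (suc j) + m ≤ rungSum j

  small<m : ∀ d → {T (d <ᵇ 5)} → d < m
  small<m d {d<5} = ≤-trans (<ᵇ⇒< d 5 d<5) (m≤m+n 5 m1)

  shift<m : ∀ d → {T (d <ᵇ 5)} → d + m1 < m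
  shift<m d {d<5} = +-monoˡ-< m1 (<ᵇ⇒< d 5 d<5)

  σ-suc≢ : ∀ x → σ x ≢ σ (x + 1)
  σ-suc≢ x = σ-shift≢ x z<s (small<m 1)

  next≋ : ∀ {r} → r < m → next r ≋ suc r
  next≋ {r} _ with nextView r
  ... | wrap e e′ = ≋-trans (≡⇒≋ e′) (≋-trans (≋-sym (+m≋ 0)) (≡⇒≋ (sym e)))
  ... | step _ e′ = ≡⇒≋ e′

  next+≋ : ∀ {r} → r < m → ∀ x → next r + x ≋ r + suc x
  next+≋ {r} r<m x = ≋-trans (≋-+ (next≋ r<m) (≡⇒≋ {x} refl)) (≡⇒≋ (sym (+-suc r x)))

  prev+2≋ : ∀ {r} → r < m → prev r + 2 ≋ r + 1
  prev+2≋ {zero}  _ = ≋-trans (≡⇒≋ (+-comm (4 + m1) 2)) (+m≋ 1)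
  prev+2≋ {suc r} _ = ≡⇒≋ (+-suc r 1)

  rim≢rim↑ : ∀ r j → σ (r + offset j) ≢ σ (r + offset (suc j))
  rim≢rim↑ r j with even j
  ... | true  = λ e → σ-shift≢ (r + 3) z<s (shift<m 1) (trans e (cong σ (sym (+-assoc r 3 (1 + m1)))))
  ... | false = λ e → σ-shift≢ (r + 3) z<s (shift<m 1) (trans (sym e) (cong σ (sym (+-assoc r 3 (1 + m1)))))

  rim≢rim-next : ∀ {r} → r < m → ∀ j → σ (r + offset j) ≢ σ (next r + offset j)
  rim≢rim-next {r} r<m j e = σ-suc≢ (r + offset j)
    (trans e (σ-cong (≋-trans (next+≋ r<m (offset j)) (≡⇒≋ (sym (+-suc-comm r (offset j)))))))
    where
    +-suc-comm : ∀ a b → a + b + 1 ≡ a + suc b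
    +-suc-comm = solve-∀

  spoke≢rim : ∀ {r} → r < m → ∀ j → suc r ≢ σ (r + offset j)
  spoke≢rim {r} r<m j e with even j
  ... | true  = σ-shift≢ r z<s (small<m 3) (trans (σ-< r<m) e)
  ... | false = σ-shift≢ r z<s (shift<m 4) (trans (σ-< r<m) e)

  rimEdge≢rim : ∀ r j → σ (r + 2) ≢ σ (r + offset j)
  rimEdge≢rim r j e with even j
  ... | true  = σ-suc≢ (r + 2) (trans e (cong σ (sym (+-assoc r 2 1))))
  ... | false = σ-shift≢ (r + 2) z<s (shift<m 2) (trans e (cong σ (sym (+-assoc r 2 (2 + m1)))))

  rimEdge≢rim-next : ∀ {r} → r < m → ∀ j → σ (r + 2) ≢ σ (next r + offset j)
  rimEdge≢rim-next {r} r<m j e with even j | σ-cong (next+≋ r<m (offset j))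
  ... | true  | e′ = σ-shift≢ (r + 2) z<s (small<m 2) (trans e (trans e′ (cong σ (sym (+-assoc r 2 2)))))
  ... | false | e′ = σ-shift≢ r z<s (small<m 2) (sym (trans e (trans e′ (σ-cong (+m≋ r)))))

  spoke≢rimEdge : ∀ {r} → r < m → suc r ≢ σ (r + 2)
  spoke≢rimEdge {r} r<m e = σ-shift≢ r z<s (small<m 2) (trans (σ-< r<m) e)

  spoke≢rimEdge-prev : ∀ {r} → r < m → suc r ≢ σ (prev r + 2)
  spoke≢rimEdge-prev {r} r<m e = σ-suc≢ r (trans (σ-< r<m) (trans e (σ-cong (prev+2≋ r<m))))

  rimEdge≢rimEdge-prev : ∀ {r} → r < m → σ (r + 2) ≢ σ (prev r + 2)
  rimEdge≢rimEdge-prev {r} r<m e =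
    σ-suc≢ (r + 1) (sym (trans (cong σ (+-assoc r 1 1)) (trans e (σ-cong (prev+2≋ r<m)))))

  spokeSum : ℕ
  spokeSum = sumℕ m suc

  rimEdgeSum : ℕ → ℕ
  rimEdgeSum r = suc r + (σ (r + 2) + σ (prev r + 2))

  rimWeight≡ : ∀ j r → rimWeight j r ≡ σ (r + offset j) + (rungSum j + rimEdgeSum r)
  rimWeight≡ zero    r = refl
  rimWeight≡ (suc j) r = refl

  rimWeight≋ : ∀ j {r} → r < m → rimWeight j r ≋ 4 * r + (7 + offset j + rungSum j)
  rimWeight≋ j {r} r<m =
    ≋-trans (≡⇒≋ (rimWeight≡ j r))
    (≋-trans (≋-+ (σ≋ (r + offset j)) (≋-+ (≡⇒≋ {rungSum j} refl) (≋-+ (≡⇒≋ {suc r} refl)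
               (≋-+ (σ≋ (r + 2)) (≋-trans (σ≋ (prev r + 2)) (≋-suc (prev+2≋ r<m)))))))
             (≡⇒≋ (normalise r (offset j) (rungSum j))))
    where
    normalise : ∀ r b P → suc (r + b) + (P + (suc r + (suc (r + 2) + suc (r + 1)))) ≡ 4 * r + (7 + b + P)
    normalise = solve-∀

  spokeSum≥ : 15 + m1 * 6 ≤ spokeSum
  spokeSum≥ = +-monoʳ-≤ 15 (≤-trans (≤-reflexive (sym (sumℕ-const m1 6))) (sumℕ-mono m1 (m≤m+n 6)))

  module _ (req : Requirements) where
    open Requirements req

    big≢ : ∀ {x y} → m < x → y ≤ m → x ≢ y
    big≢ m<x y≤m refl = <⇒≱ m<x y≤m

    rungOf≢σ : ∀ {j} x → suc j < n → rungOf j ≢ σ x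
    rungOf≢σ x j+1<n = big≢ (proj₁ (rungOf-range _ j+1<n)) (σ≤m x)

    rungOf≢spoke : ∀ {j r} → suc j < n → r < m → rungOf j ≢ suc r
    rungOf≢spoke j+1<n r<m = big≢ (proj₁ (rungOf-range _ j+1<n)) r<m

    big-range : ∀ {x} → m < x × x ≤ k → IsColour x
    big-range (m<x , x≤k) = ≤-trans (s≤s z≤n) m<x , x≤k

    σ-range : ∀ x → IsColour (σ x)
    σ-range x = 1≤σ x , ≤-trans (σ≤m x) m≤k

    weight-centre≢rim : ∀ j r → j < n → r < m → centreWeight j ≢ rimWeight j r
    weight-centre≢rim j r j<n r<m e = <⇒≢ rim<centre
      (sym (+-cancelˡ-≡ (rungSum j) _ _ (trans (sym (swap (centreOf j) (rungSum j) spokeSum))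
        (trans e (trans (rimWeight≡ j r) (swap (σ (r + offset j)) (rungSum j) (rimEdgeSum r)))))))
      where
      swap : ∀ a p c → a + (p + c) ≡ p + (a + c)
      swap = solve-∀
      count : ∀ m1 → suc ((5 + m1) + ((5 + m1) + ((5 + m1) + (5 + m1)))) + 3 * m1 ≡ (6 + m1) + (15 + m1 * 6)
      count = solve-∀
      rim<centre : σ (r + offset j) + rimEdgeSum r < centreOf j + spokeSum
      rim<centre = begin-strict
        σ (r + offset j) + rimEdgeSum r  ≤⟨ +-mono-≤ (σ≤m (r + offset j))
                                              (+-mono-≤ r<m (+-mono-≤ (σ≤m (r + 2)) (σ≤m (prev r + 2)))) ⟩
        m + (m + (m + m))                <⟨ s≤s (m≤m+n _ (3 * m1)) ⟩
        suc (m + (m + (m + m))) + 3 * m1 ≡⟨ count m1 ⟩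
        (6 + m1) + (15 + m1 * 6)         ≤⟨ +-mono-≤ (proj₁ (centreOf-range j j<n)) spokeSum≥ ⟩
        centreOf j + spokeSum            ∎
        where open ≤-Reasoning

    weight-rim≢rim-next : ∀ j r → j < n → r < m → rimWeight j r ≢ rimWeight j (next r)
    weight-rim≢rim-next j r _ r<m e = σ-shift≢ (4 * r + c) z<s (small<m 4) (σ-cong (begin≋))
      where
      c : ℕ
      c = 7 + offset j + rungSum j
      begin≋ : 4 * r + c ≋ 4 * r + c + 4
      begin≋ = ≋-trans (≋-sym (rimWeight≋ j r<m)) (≋-trans (≡⇒≋ e) (≋-trans (rimWeight≋ j (next<m r<m))
                 (≋-trans (≋-+ (≋-*ˡ 4 (next≋ r<m)) (≡⇒≋ {c} refl)) (≡⇒≋ (shift r c)))))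
        where
        shift : ∀ r c → 4 * suc r + c ≡ 4 * r + c + 4
        shift = solve-∀

    weight-centre≢centre↑ : ∀ j → suc j < n → centreWeight j ≢ centreWeight (suc j)
    weight-centre≢centre↑ j j+1<n e = centre-weights≢ j j+1<n (+-cancelʳ-≡ spokeSum _ _
      (trans (+-assoc (centreOf j) _ spokeSum) (trans e (sym (+-assoc (centreOf (suc j)) _ spokeSum)))))

    weight-rim≢rim↑ : ∀ j r → suc j < n → r < m → rimWeight j r ≢ rimWeight (suc j) r
    weight-rim≢rim↑ j r j+1<n _ e = apart (rungSums-apart j j+1<n)
      where
      e′ : σ (r + offset j) + rungSum j ≡ σ (r + offset (suc j)) + rungSum (suc j)
      e′ = +-cancelʳ-≡ (rimEdgeSum r) _ _ (trans (+-assoc (σ (r + offset j)) _ _)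
             (trans (trans (sym (rimWeight≡ j r)) (trans e (rimWeight≡ (suc j) r)))
                    (sym (+-assoc (σ (r + offset (suc j))) _ _))))
      below : ∀ {x P x′ P′} → P + m ≤ P′ → x ≤ m → 1 ≤ x′ → x + P < x′ + P′
      below {x} {P} {x′} {P′} P+m≤P′ x≤m 1≤x′ = begin-strict
        x + P    ≤⟨ +-monoˡ-≤ P x≤m ⟩
        m + P    ≡⟨ +-comm m P ⟩
        P + m    ≤⟨ P+m≤P′ ⟩
        P′       <⟨ +-monoˡ-≤ P′ 1≤x′ ⟩
        x′ + P′  ∎
        where open ≤-Reasoning
      apart : rungSum j ≡ rungSum (suc j) ⊎ rungSum j + m ≤ rungSum (suc j) ⊎ rungSum (suc j) + m ≤ rungSum j → ⊥
      apart (inj₁ P≡P′) = rim≢rim↑ r j (+-cancelʳ-≡ (rungSum j) _ _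
        (trans e′ (cong (σ (r + offset (suc j)) +_) (sym P≡P′))))
      apart (inj₂ (inj₁ P+m≤P′)) = <⇒≢ (below P+m≤P′ (σ≤m (r + offset j)) (1≤σ (r + offset (suc j)))) e′
      apart (inj₂ (inj₂ P′+m≤P)) = <⇒≢ (below P′+m≤P (σ≤m (r + offset (suc j))) (1≤σ (r + offset j))) (sym e′)

    admissible : Admissible
    admissible = record
      { centre-range           = λ j j<n → big-range (centreOf-range j j<n)
      ; rim-range              = λ j r _ _ → σ-range (r + offset j)
      ; spoke-range            = λ _ _ _ r<m → s≤s z≤n , ≤-trans r<m m≤k
      ; rimEdge-range          = λ _ r _ _ → σ-range (r + 2)
      ; centreRung-range       = λ j j+1<n → big-range (rungOf-range j j+1<n)
      ; rimRung-range          = λ j _ j+1<n _ → big-range (rungOf-range j j+1<n)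
      ; centre≢centre↑         = centreOf≢centreOf↑
      ; rim≢rim↑               = λ j r _ _ → rim≢rim↑ r j
      ; centre≢rim             = λ j r j<n _ → big≢ (proj₁ (centreOf-range j j<n)) (σ≤m (r + offset j))
      ; rim≢rim-next           = λ j _ _ r<m → rim≢rim-next r<m j
      ; centreRung≢centreRung↑ = rungOf≢rungOf↑
      ; centreRung≢spoke       = λ _ _ → rungOf≢spoke
      ; centreRung≢spoke↑      = λ _ _ → rungOf≢spoke
      ; spoke-injective        = λ _ _ _ _ _ _ r≢r′ → r≢r′ ∘ suc-injective
      ; rimRung≢rimRung↑       = λ j _ j+2<n _ → rungOf≢rungOf↑ j j+2<n
      ; rimRung≢spoke          = λ _ _ → rungOf≢spoke
      ; rimRung≢rimEdge        = λ _ r j+1<n _ → rungOf≢σ (r + 2) j+1<n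
      ; rimRung≢rimEdge-prev   = λ _ r j+1<n _ → rungOf≢σ (prev r + 2) j+1<n
      ; rimRung≢spoke↑         = λ _ _ → rungOf≢spoke
      ; rimRung≢rimEdge↑       = λ _ r j+1<n _ → rungOf≢σ (r + 2) j+1<n
      ; rimRung≢rimEdge-prev↑  = λ _ r j+1<n _ → rungOf≢σ (prev r + 2) j+1<n
      ; spoke≢rimEdge          = λ _ _ _ → spoke≢rimEdge
      ; spoke≢rimEdge-prev     = λ _ _ _ → spoke≢rimEdge-prev
      ; rimEdge≢rimEdge-prev   = λ _ _ _ → rimEdge≢rimEdge-prev
      ; centreRung≢centre      = rungOf≢centreOf
      ; rimRung≢rim            = λ j r j+1<n _ → rungOf≢σ (r + offset j) j+1<n
      ; centreRung≢centre↑     = rungOf≢centreOf↑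
      ; rimRung≢rim↑           = λ j r j+1<n _ → rungOf≢σ (r + offset (suc j)) j+1<n
      ; spoke≢centre           = λ j _ j<n r<m → big≢ (proj₁ (centreOf-range j j<n)) r<m ∘ sym
      ; spoke≢rim              = λ j _ _ r<m → spoke≢rim r<m j
      ; rimEdge≢rim            = λ j r _ _ → rimEdge≢rim r j
      ; rimEdge≢rim-next       = λ j _ _ r<m → rimEdge≢rim-next r<m j
      ; weight-centre≢rim      = weight-centre≢rim
      ; weight-rim≢rim-next    = weight-rim≢rim-next
      ; weight-centre≢centre↑  = weight-centre≢centre↑
      ; weight-rim≢rim↑        = weight-rim≢rim↑
      }

  hasModular : Requirements → HasSumDistTotal G k
  hasModular req = hasSumDistTotal (admissible req)


module ModularInstances (m1 : ℕ) where
  private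
    m : ℕ
    m = 5 + m1

    above-m : ∀ c d → {T (1 ≤ᵇ c)} → {T (c ≤ᵇ d)} → m < c + m × c + m ≤ d + m
    above-m c d {1≤c} {c≤d} = +-monoˡ-≤ m (≤ᵇ⇒≤ 1 c 1≤c) , +-monoˡ-≤ m (≤ᵇ⇒≤ c d c≤d)

    +m≢ : ∀ a b → {T (not (a ≡ᵇ b))} → a + m ≢ b + m
    +m≢ a b {a≢b} e = subst (T ∘ not) (≡ᵇ-true a b (+-cancelʳ-≡ m a b e)) a≢b

    <-by : ∀ {a b} c → b ≡ a + suc c → a ≢ b
    <-by {a} c b≡ a≡b = m≢m+1+n a (trans a≡b b≡)
      where
      m≢m+1+n : ∀ m {n} → m ≢ m + suc n
      m≢m+1+n m e = <-irrefl e (m<m+n m z<s)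

    >-by : ∀ {a b} c → a ≡ b + suc c → a ≢ b
    >-by c a≡ = <-by c a≡ ∘ sym

    apart-by : ∀ a {b} c → b ≡ a + m + c → a + m ≤ b
    apart-by a c b≡ = ≤-trans (m≤m+n (a + m) c) (≤-reflexive (sym b≡))

  module TwoLayers where
    centreOf rungOf : ℕ → ℕ
    centreOf zero    = 2 + m
    centreOf (suc _) = 3 + m
    rungOf _ = 1 + m

    open ModularColouring m1 2 (3 + m) centreOf rungOf using (Requirements; hasModular)

    requirements : Requirements
    requirements = record
      { m≤k                = m≤n+m m 3
      ; centreOf-range     = λ { 0 _ → above-m 2 3 ; 1 _ → above-m 3 3 ; (suc (suc _)) (s≤s (s≤s ())) }
      ; rungOf-range       = λ { 0 _ → above-m 1 3 ; (suc _) (s≤s (s≤s ())) }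
      ; centreOf≢centreOf↑ = λ { 0 _ → +m≢ 2 3 ; (suc _) (s≤s (s≤s ())) }
      ; rungOf≢rungOf↑     = λ { _ (s≤s (s≤s ())) }
      ; rungOf≢centreOf    = λ { 0 _ → +m≢ 1 2 ; (suc _) (s≤s (s≤s ())) }
      ; rungOf≢centreOf↑   = λ { 0 _ → +m≢ 1 3 ; (suc _) (s≤s (s≤s ())) }
      ; centre-weights≢    = λ { 0 _ → <-by 0 (weights m) ; (suc _) (s≤s (s≤s ())) }
      ; rungSums-apart     = λ { 0 _ → inj₁ (+-identityʳ (1 + m)) ; (suc _) (s≤s (s≤s ())) }
      }
      where
      weights : ∀ m → (3 + m) + (0 + (1 + m)) ≡ ((2 + m) + ((1 + m) + 0)) + 1
      weights = solve-∀

    has : HasSumDistTotal (wheel m □ pathGraph 2) (3 + m)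
    has = hasModular requirements

  module ThreeLayers where
    centreOf rungOf : ℕ → ℕ
    centreOf 0 = 2 + m
    centreOf 1 = 3 + m
    centreOf _ = 1 + m
    rungOf 0 = 1 + m
    rungOf _ = 2 + m

    open ModularColouring m1 3 (3 + m) centreOf rungOf using (Requirements; hasModular)

    requirements : Requirements
    requirements = record
      { m≤k                = m≤n+m m 3
      ; centreOf-range     = λ { 0 _ → above-m 2 3 ; 1 _ → above-m 3 3 ; 2 _ → above-m 1 3
                               ; (suc (suc (suc _))) (s≤s (s≤s (s≤s ()))) }
      ; rungOf-range       = λ { 0 _ → above-m 1 3 ; 1 _ → above-m 2 3 ; (suc (suc _)) (s≤s (s≤s (s≤s ()))) }
      ; centreOf≢centreOf↑ = λ { 0 _ → +m≢ 2 3 ; 1 _ → +m≢ 3 1 ; (suc (suc _)) (s≤s (s≤s (s≤s ()))) }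
      ; rungOf≢rungOf↑     = λ { 0 _ → +m≢ 1 2 ; (suc _) (s≤s (s≤s (s≤s ()))) }
      ; rungOf≢centreOf    = λ { 0 _ → +m≢ 1 2 ; 1 _ → +m≢ 2 3 ; (suc (suc _)) (s≤s (s≤s (s≤s ()))) }
      ; rungOf≢centreOf↑   = λ { 0 _ → +m≢ 1 3 ; 1 _ → +m≢ 2 1 ; (suc (suc _)) (s≤s (s≤s (s≤s ()))) }
      ; centre-weights≢    = λ { 0 _ → <-by (2 + m) (weights₀ m) ; 1 _ → >-by (2 + m) (weights₁ m)
                               ; (suc (suc _)) (s≤s (s≤s (s≤s ()))) }
      ; rungSums-apart     = λ { 0 _ → inj₂ (inj₁ (apart-by ((1 + m) + 0) 2 (rungs₀ m)))
                               ; 1 _ → inj₂ (inj₂ (apart-by (0 + (2 + m)) 1 (rungs₁ m)))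
                               ; (suc (suc _)) (s≤s (s≤s (s≤s ()))) }
      }
      where
      weights₀ : ∀ m → (3 + m) + ((2 + m) + (1 + m)) ≡ ((2 + m) + ((1 + m) + 0)) + suc (2 + m)
      weights₀ = solve-∀
      weights₁ : ∀ m → (3 + m) + ((2 + m) + (1 + m)) ≡ ((1 + m) + (0 + (2 + m))) + suc (2 + m)
      weights₁ = solve-∀
      rungs₀ : ∀ m → (2 + m) + (1 + m) ≡ ((1 + m) + 0) + m + 2
      rungs₀ = solve-∀
      rungs₁ : ∀ m → (2 + m) + (1 + m) ≡ (0 + (2 + m)) + m + 1
      rungs₁ = solve-∀

    has : HasSumDistTotal (wheel m □ pathGraph 3) (3 + m)
    has = hasModular requirements

  module ManyLayers (n′ : ℕ) where
    centreOf rungOf : ℕ → ℕ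
    centreOf j = if even j then 3 + m else 4 + m
    rungOf j = if even j then 1 + m else 2 + m

    open ModularColouring m1 (4 + n′) (4 + m) centreOf rungOf using (rungSum; hasModular)

    private
      middle : ∀ m → (4 + m) + ((2 + m) + (1 + m)) ≡ ((3 + m) + ((1 + m) + (2 + m))) + 1
      middle = solve-∀
      last₀ : ∀ m → (4 + m) + ((2 + m) + (1 + m)) ≡ ((3 + m) + (0 + (2 + m))) + suc (1 + m)
      last₀ = solve-∀
      last₁ : ∀ m → (3 + m) + ((1 + m) + (2 + m)) ≡ ((4 + m) + (0 + (1 + m))) + suc m
      last₁ = solve-∀
      lastRungs₀ : ∀ m → (2 + m) + (1 + m) ≡ (0 + (2 + m)) + m + 1
      lastRungs₀ = solve-∀
      lastRungs₁ : ∀ m → (1 + m) + (2 + m) ≡ (0 + (1 + m)) + m + 2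
      lastRungs₁ = solve-∀

    centreOf-range′ : ∀ j → m < centreOf j × centreOf j ≤ 4 + m
    centreOf-range′ j with even j
    ... | true  = above-m 3 4
    ... | false = above-m 4 4

    rungOf-range′ : ∀ j → m < rungOf j × rungOf j ≤ 4 + m
    rungOf-range′ j with even j
    ... | true  = above-m 1 4
    ... | false = above-m 2 4

    centreOf≢centreOf↑′ : ∀ j → centreOf j ≢ centreOf (suc j)
    centreOf≢centreOf↑′ j with even j
    ... | true  = +m≢ 3 4
    ... | false = +m≢ 4 3

    rungOf≢rungOf↑′ : ∀ j → rungOf j ≢ rungOf (suc j)
    rungOf≢rungOf↑′ j with even j
    ... | true  = +m≢ 1 2
    ... | false = +m≢ 2 1

    rungOf≢centreOf′ : ∀ j → rungOf j ≢ centreOf j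
    rungOf≢centreOf′ j with even j
    ... | true  = +m≢ 1 3
    ... | false = +m≢ 2 4

    rungOf≢centreOf↑′ : ∀ j → rungOf j ≢ centreOf (suc j)
    rungOf≢centreOf↑′ j with even j
    ... | true  = +m≢ 1 4
    ... | false = +m≢ 2 3

    centre-weights≢′ : ∀ j → suc j < 4 + n′ → centreOf j + rungSum j ≢ centreOf (suc j) + rungSum (suc j)
    centre-weights≢′ zero    _ = <-by (2 + m) (first m)
      where
      first : ∀ m → (4 + m) + ((2 + m) + (1 + m)) ≡ ((3 + m) + ((1 + m) + 0)) + suc (2 + m)
      first = solve-∀
    centre-weights≢′ (suc j) j+2<n rewrite <ᵇ-true j+2<n with suc (suc (suc j)) <ᵇ 4 + n′ | even j
    ... | true  | true  = >-by 0 (middle m)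
    ... | true  | false = <-by 0 (middle m)
    ... | false | true  = >-by (1 + m) (last₀ m)
    ... | false | false = >-by m (last₁ m)

    rungSums-apart′ : ∀ j → suc j < 4 + n′ →
      rungSum j ≡ rungSum (suc j) ⊎ rungSum j + m ≤ rungSum (suc j) ⊎ rungSum (suc j) + m ≤ rungSum j
    rungSums-apart′ zero    _ = inj₂ (inj₁ (apart-by ((1 + m) + 0) 2 (first m)))
      where
      first : ∀ m → (2 + m) + (1 + m) ≡ ((1 + m) + 0) + m + 2
      first = solve-∀
    rungSums-apart′ (suc j) j+2<n rewrite <ᵇ-true j+2<n with suc (suc (suc j)) <ᵇ 4 + n′ | even j
    ... | true  | true  = inj₁ (+-comm (2 + m) (1 + m))
    ... | true  | false = inj₁ (+-comm (1 + m) (2 + m))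
    ... | false | true  = inj₂ (inj₂ (apart-by (0 + (2 + m)) 1 (lastRungs₀ m)))
    ... | false | false = inj₂ (inj₂ (apart-by (0 + (1 + m)) 2 (lastRungs₁ m)))

    has : HasSumDistTotal (wheel m □ pathGraph (4 + n′)) (4 + m)
    has = hasModular (record
      { m≤k                = m≤n+m m 4
      ; centreOf-range     = λ j _ → centreOf-range′ j
      ; rungOf-range       = λ j _ → rungOf-range′ j
      ; centreOf≢centreOf↑ = λ j _ → centreOf≢centreOf↑′ j
      ; rungOf≢rungOf↑     = λ j _ → rungOf≢rungOf↑′ j
      ; rungOf≢centreOf    = λ j _ → rungOf≢centreOf′ j
      ; rungOf≢centreOf↑   = λ j _ → rungOf≢centreOf↑′ j
      ; centre-weights≢    = centre-weights≢′
      ; rungSums-apart     = rungSums-apart′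
      })

-- The colourings for m = 3, 4 depend on a layer only through its kind: the first
-- layer, the last one, and the middle layers by parity.
data Kind : Set where
  first middle₀ middle₁ last : Kind

kind : ℕ → ℕ → Kind
kind n zero    = first
kind n (suc j) = if suc (suc j) ≡ᵇ n then last else (if even (suc j) then middle₀ else middle₁)

isFirst isLast : Kind → Bool
isFirst first = true
isFirst _     = false
isLast last = true
isLast _    = false

-- The pairs (kind (j - 1), kind j) for j < n and the triples
-- (kind (j - 1), kind j, kind (j + 1)) for j + 1 < n, where 0 - 1 = 0.
kindPairs : ℕ → List (Kind × Kind)
kindPairs 2 = (first , first) ∷ (first , last) ∷ []
kindPairs 3 = (first , first) ∷ (first , middle₁) ∷ (middle₁ , last) ∷ []
kindPairs (suc (suc (suc (suc _)))) =
  (first , first) ∷ (first , middle₁) ∷ (middle₁ , middle₀) ∷ (middle₀ , middle₁)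
  ∷ (middle₀ , last) ∷ (middle₁ , last) ∷ []
kindPairs _ = []

kindTriples : ℕ → List (Kind × Kind × Kind)
kindTriples 2 = (first , first , last) ∷ []
kindTriples 3 = (first , first , middle₁) ∷ (first , middle₁ , last) ∷ []
kindTriples (suc (suc (suc (suc _)))) =
  (first , first , middle₁) ∷ (first , middle₁ , middle₀) ∷ (middle₁ , middle₀ , middle₁)
  ∷ (middle₀ , middle₁ , middle₀) ∷ (middle₁ , middle₀ , last) ∷ (middle₀ , middle₁ , last) ∷ []
kindTriples _ = []

kindPair∈ : ∀ {n j} → 2 ≤ n → j < n → (kind n (pred j) , kind n j) ∈ kindPairs n
kindPair∈ {2} {0} _ _ = here refl
kindPair∈ {2} {1} _ _ = there (here refl)
kindPair∈ {3} {0} _ _ = here refl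
kindPair∈ {3} {1} _ _ = there (here refl)
kindPair∈ {3} {2} _ _ = there (there (here refl))
kindPair∈ {suc (suc (suc (suc n′)))} {0} _ _ = here refl
kindPair∈ {suc (suc (suc (suc n′)))} {1} _ _ = there (here refl)
kindPair∈ {suc (suc (suc (suc n′)))} {suc (suc j)} _ (s≤s (s≤s j<2+n′))
  rewrite ≡ᵇ-false j (suc (suc n′)) (<⇒≢ j<2+n′) with j ≡ᵇ suc n′ | even j
... | true  | true  = there (there (there (there (there (here refl)))))
... | true  | false = there (there (there (there (here refl))))
... | false | true  = there (there (here refl))
... | false | false = there (there (there (here refl)))
kindPair∈ {1} (s≤s ()) _
kindPair∈ {2} {suc (suc _)} _ (s≤s (s≤s ()))
kindPair∈ {3} {suc (suc (suc _))} _ (s≤s (s≤s (s≤s ())))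

kindTriple∈ : ∀ {n j} → 2 ≤ n → suc j < n → (kind n (pred j) , kind n j , kind n (suc j)) ∈ kindTriples n
kindTriple∈ {2} {0} _ _ = here refl
kindTriple∈ {3} {0} _ _ = here refl
kindTriple∈ {3} {1} _ _ = there (here refl)
kindTriple∈ {suc (suc (suc (suc n′)))} {0} _ _ = here refl
kindTriple∈ {suc (suc (suc (suc n′)))} {1} _ _ = there (here refl)
kindTriple∈ {suc (suc (suc (suc n′)))} {suc (suc j)} _ (s≤s (s≤s (s≤s j<1+n′)))
  rewrite ≡ᵇ-false j (suc (suc n′)) (<⇒≢ (m<n⇒m<1+n j<1+n′)) | ≡ᵇ-false j (suc n′) (<⇒≢ j<1+n′)
  with j ≡ᵇ n′ | even j
... | true  | true  = there (there (there (there (here refl))))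
... | true  | false = there (there (there (there (there (here refl)))))
... | false | true  = there (there (here refl))
... | false | false = there (there (there (here refl)))
kindTriple∈ {1} (s≤s ()) _
kindTriple∈ {2} {suc _} _ (s≤s (s≤s ()))
kindTriple∈ {3} {suc (suc _)} _ (s≤s (s≤s (s≤s ())))

<ᵇ-kind : ∀ {n j} → 2 ≤ n → j < n → (suc j <ᵇ n) ≡ not (isLast (kind n j))
<ᵇ-kind {1} {zero} (s≤s ()) _
<ᵇ-kind {suc (suc n)} {zero} _ _ = refl
<ᵇ-kind {n} {suc j} _ j<n with suc (suc j) ≡ᵇ n in eq
... | true  rewrite ≡ᵇ⇒≡ (suc (suc j)) n (subst T (sym eq) tt) = ¬T⇒≡false (<-irrefl refl ∘ <ᵇ⇒< n n)
... | false = trans (<ᵇ-true (≤∧≢⇒< j<n (λ e → subst T eq (≡⇒≡ᵇ (suc (suc j)) n e))))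
                    (middle-not-last (even (suc j)))
  where
  middle-not-last : ∀ b → true ≡ not (isLast (if b then middle₀ else middle₁))
  middle-not-last true  = refl
  middle-not-last false = refl

isFirst-kind-suc : ∀ n j → isFirst (kind n (suc j)) ≡ false
isFirst-kind-suc n j with suc (suc j) ≡ᵇ n
... | true = refl
... | false with even (suc j)
...   | true  = refl
...   | false = refl

_≢ᵇ_ : ℕ → ℕ → Bool
a ≢ᵇ b = not (a ≡ᵇ b)

≢ᵇ⇒≢ : ∀ {a b} → T (a ≢ᵇ b) → a ≢ b
≢ᵇ⇒≢ {a} t refl = subst (T ∘ not) (≡ᵇ-true a a refl) t

all< : ℕ → (ℕ → Bool) → Bool
all< zero    p = true
all< (suc N) p = p 0 ∧ all< N (p ∘ suc)

all<⇒ : ∀ {N p} → T (all< N p) → ∀ {r} → r < N → T (p r)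
all<⇒ {suc N} {p} t {zero}  _   = proj₁ (Equivalence.to (T-∧ {p 0}) t)
all<⇒ {suc N} {p} t {suc r} r<N = all<⇒ (proj₂ (Equivalence.to (T-∧ {p 0}) t)) (s<s⁻¹ r<N)

-- A record, so that the predicate can be recovered from the type.
record AllBelow (N : ℕ) (p : ℕ → Bool) : Set where
  constructor allBelow
  field holds : T (all< N p)

AllBelow⇒ : ∀ {N p} → AllBelow N p → ∀ {r} → r < N → T (p r)
AllBelow⇒ (allBelow t) = all<⇒ t

T-∨ʳ : ∀ {a b} → T (a ∨ b) → a ≡ false → T b
T-∨ʳ t refl = t

-- A conjunction over a list that computes to ⊤ when each conjunct does, so that it is
-- proved by '_' once the list and the conjuncts are closed.
Every : {A : Set} → (A → Set) → List A → Set
Every P []       = ⊤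
Every P (x ∷ xs) = P x × Every P xs

Every-∈ : ∀ {A : Set} {P : A → Set} {x xs} → Every P xs → x ∈ xs → P x
Every-∈ (p , _)  (here refl) = p
Every-∈ (_ , ps) (there x∈)  = Every-∈ ps x∈

module KindColouring (m0 n k : ℕ) (2≤n : 2 ≤ n) (K : Palette Kind) where
  open LayeredColouring m0 n k
  open Palette K
  open Colouring (reindex (kind n) K)

  isColourᵇ : ℕ → Bool
  isColourᵇ x = (1 ≤ᵇ x) ∧ (x ≤ᵇ k)

  isColourᵇ⇒ : ∀ {x} → T (isColourᵇ x) → IsColour x
  isColourᵇ⇒ {x} t = ≤ᵇ⇒≤ 1 x (proj₁ (Equivalence.to (T-∧ {1 ≤ᵇ x}) t))
                   , ≤ᵇ⇒≤ x k (proj₂ (Equivalence.to (T-∧ {1 ≤ᵇ x}) t))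

  rungK : Kind → ℕ → ℕ
  rungK Q zero    = centreRung Q
  rungK Q (suc r) = rimRung Q r

  rungsK : Kind → Kind → ℕ → ℕ
  rungsK P Q a = (if isLast Q then 0 else rungK Q a) + (if isFirst Q then 0 else rungK P a)

  centreWeightK : Kind → Kind → ℕ
  centreWeightK P Q = centre Q + (rungsK P Q 0 + sumℕ m (spoke Q))

  rimWeightK : Kind → Kind → ℕ → ℕ
  rimWeightK P Q r = rim Q r + (rungsK P Q (suc r) + (spoke Q r + (rimEdge Q r + rimEdge Q (prev r))))

  rungs≡rungsK : ∀ a {j} → j < n → upRung a j + downRung a j ≡ rungsK (kind n (pred j)) (kind n j) a
  rungs≡rungsK a {j} j<n = cong₂ _+_ above (below j)
    where
    rungColour≡ : ∀ l a → rungColour l a ≡ rungK (kind n l) a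
    rungColour≡ l zero    = refl
    rungColour≡ l (suc r) = refl
    if-not : ∀ b (x : ℕ) → ([ not b ] x) ≡ (if b then 0 else x)
    if-not true  x = refl
    if-not false x = refl
    above : upRung a j ≡ (if isLast (kind n j) then 0 else rungK (kind n j) a)
    above rewrite <ᵇ-kind 2≤n j<n | rungColour≡ j a = if-not (isLast (kind n j)) _
    below : ∀ j → downRung a j ≡ (if isFirst (kind n j) then 0 else rungK (kind n (pred j)) a)
    below zero    = refl
    below (suc l) rewrite isFirst-kind-suc n l = rungColour≡ l a

  centreWeight≡ : ∀ {j} → j < n → centreWeight j ≡ centreWeightK (kind n (pred j)) (kind n j)
  centreWeight≡ {j} j<n = cong (λ t → centre (kind n j) + (t + sumℕ m (spoke (kind n j)))) (rungs≡rungsK 0 j<n)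

  rimWeight≡ : ∀ {j} r → j < n → rimWeight j r ≡ rimWeightK (kind n (pred j)) (kind n j) r
  rimWeight≡ {j} r j<n = cong (λ t → rim (kind n j) r + (t + (spoke (kind n j) r
    + (rimEdge (kind n j) r + rimEdge (kind n j) (prev r))))) (rungs≡rungsK (suc r) j<n)

  -- The conditions of Admissible within layer j, in terms of the kinds P, Q of layers
  -- j - 1 and j …
  record PairOK (P Q : Kind) : Set where
    field
      centre-range         : T (isColourᵇ (centre Q))
      rim-range            : AllBelow m (λ r → isColourᵇ (rim Q r))
      spoke-range          : AllBelow m (λ r → isColourᵇ (spoke Q r))
      rimEdge-range        : AllBelow m (λ r → isColourᵇ (rimEdge Q r))
      centre≢rim           : AllBelow m (λ r → centre Q ≢ᵇ rim Q r)
      rim≢rim-next         : AllBelow m (λ r → rim Q r ≢ᵇ rim Q (next r))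
      spoke-injective      : AllBelow m (λ r → all< m λ r′ → (r ≡ᵇ r′) ∨ (spoke Q r ≢ᵇ spoke Q r′))
      spoke≢rimEdge        : AllBelow m (λ r → spoke Q r ≢ᵇ rimEdge Q r)
      spoke≢rimEdge-prev   : AllBelow m (λ r → spoke Q r ≢ᵇ rimEdge Q (prev r))
      rimEdge≢rimEdge-prev : AllBelow m (λ r → rimEdge Q r ≢ᵇ rimEdge Q (prev r))
      spoke≢centre         : AllBelow m (λ r → spoke Q r ≢ᵇ centre Q)
      spoke≢rim            : AllBelow m (λ r → spoke Q r ≢ᵇ rim Q r)
      rimEdge≢rim          : AllBelow m (λ r → rimEdge Q r ≢ᵇ rim Q r)
      rimEdge≢rim-next     : AllBelow m (λ r → rimEdge Q r ≢ᵇ rim Q (next r))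
      weight-centre≢rim    : AllBelow m (λ r → centreWeightK P Q ≢ᵇ rimWeightK P Q r)
      weight-rim≢rim-next  : AllBelow m (λ r → rimWeightK P Q r ≢ᵇ rimWeightK P Q (next r))

  -- … and those between layers j and j + 1, with P, Q, R the kinds of j - 1, j, j + 1.
  record TripleOK (P Q R : Kind) : Set where
    field
      centreRung-range       : T (isColourᵇ (centreRung Q))
      rimRung-range          : AllBelow m (λ r → isColourᵇ (rimRung Q r))
      centre≢centre↑         : T (centre Q ≢ᵇ centre R)
      rim≢rim↑               : AllBelow m (λ r → rim Q r ≢ᵇ rim R r)
      centreRung≢centreRung↑ : T (isFirst Q ∨ (centreRung P ≢ᵇ centreRung Q))
      centreRung≢spoke       : AllBelow m (λ r → centreRung Q ≢ᵇ spoke Q r)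
      centreRung≢spoke↑      : AllBelow m (λ r → centreRung Q ≢ᵇ spoke R r)
      rimRung≢rimRung↑       : AllBelow m (λ r → isFirst Q ∨ (rimRung P r ≢ᵇ rimRung Q r))
      rimRung≢spoke          : AllBelow m (λ r → rimRung Q r ≢ᵇ spoke Q r)
      rimRung≢rimEdge        : AllBelow m (λ r → rimRung Q r ≢ᵇ rimEdge Q r)
      rimRung≢rimEdge-prev   : AllBelow m (λ r → rimRung Q r ≢ᵇ rimEdge Q (prev r))
      rimRung≢spoke↑         : AllBelow m (λ r → rimRung Q r ≢ᵇ spoke R r)
      rimRung≢rimEdge↑       : AllBelow m (λ r → rimRung Q r ≢ᵇ rimEdge R r)
      rimRung≢rimEdge-prev↑  : AllBelow m (λ r → rimRung Q r ≢ᵇ rimEdge R (prev r))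
      centreRung≢centre      : T (centreRung Q ≢ᵇ centre Q)
      rimRung≢rim            : AllBelow m (λ r → rimRung Q r ≢ᵇ rim Q r)
      centreRung≢centre↑     : T (centreRung Q ≢ᵇ centre R)
      rimRung≢rim↑           : AllBelow m (λ r → rimRung Q r ≢ᵇ rim R r)
      weight-centre≢centre↑  : T (centreWeightK P Q ≢ᵇ centreWeightK Q R)
      weight-rim≢rim↑        : AllBelow m (λ r → rimWeightK P Q r ≢ᵇ rimWeightK Q R r)

  module _ (pairs   : Every (λ (P , Q) → PairOK P Q) (kindPairs n))
           (triples : Every (λ (P , Q , R) → TripleOK P Q R) (kindTriples n)) where

    pair : ∀ {j} → j < n → PairOK (kind n (pred j)) (kind n j)
    pair j<n = Every-∈ pairs (kindPair∈ 2≤n j<n)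

    triple : ∀ {j} → suc j < n → TripleOK (kind n (pred j)) (kind n j) (kind n (suc j))
    triple j+1<n = Every-∈ triples (kindTriple∈ 2≤n j+1<n)

    admissible : Admissible
    admissible = record
      { centre-range           = λ _ j<n → isColourᵇ⇒ (PairOK.centre-range (pair j<n))
      ; rim-range              = λ _ _ j<n r<m → isColourᵇ⇒ (AllBelow⇒ (PairOK.rim-range (pair j<n)) r<m)
      ; spoke-range            = λ _ _ j<n r<m → isColourᵇ⇒ (AllBelow⇒ (PairOK.spoke-range (pair j<n)) r<m)
      ; rimEdge-range          = λ _ _ j<n r<m → isColourᵇ⇒ (AllBelow⇒ (PairOK.rimEdge-range (pair j<n)) r<m)
      ; centreRung-range       = λ _ q → isColourᵇ⇒ (TripleOK.centreRung-range (triple q))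
      ; rimRung-range          = λ _ _ q r<m → isColourᵇ⇒ (AllBelow⇒ (TripleOK.rimRung-range (triple q)) r<m)
      ; centre≢centre↑         = λ _ q → ≢ᵇ⇒≢ (TripleOK.centre≢centre↑ (triple q))
      ; rim≢rim↑               = λ _ _ q r<m → ≢ᵇ⇒≢ (AllBelow⇒ (TripleOK.rim≢rim↑ (triple q)) r<m)
      ; centre≢rim             = λ _ _ j<n r<m → ≢ᵇ⇒≢ (AllBelow⇒ (PairOK.centre≢rim (pair j<n)) r<m)
      ; rim≢rim-next           = λ _ _ j<n r<m → ≢ᵇ⇒≢ (AllBelow⇒ (PairOK.rim≢rim-next (pair j<n)) r<m)
      ; centreRung≢centreRung↑ = λ j q → ≢ᵇ⇒≢ (T-∨ʳ (TripleOK.centreRung≢centreRung↑ (triple q))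
                                                    (isFirst-kind-suc n j))
      ; centreRung≢spoke       = λ _ _ q r<m → ≢ᵇ⇒≢ (AllBelow⇒ (TripleOK.centreRung≢spoke (triple q)) r<m)
      ; centreRung≢spoke↑      = λ _ _ q r<m → ≢ᵇ⇒≢ (AllBelow⇒ (TripleOK.centreRung≢spoke↑ (triple q)) r<m)
      ; spoke-injective        = λ j r r′ j<n r<m r′<m r≢r′ → ≢ᵇ⇒≢ (T-∨ʳ
          (all<⇒ {p = λ r′ → (r ≡ᵇ r′) ∨ (spoke (kind n j) r ≢ᵇ spoke (kind n j) r′)}
            (AllBelow⇒ (PairOK.spoke-injective (pair j<n)) r<m) r′<m) (≡ᵇ-false r r′ r≢r′))
      ; rimRung≢rimRung↑       = λ j _ q r<m → ≢ᵇ⇒≢ (T-∨ʳ (AllBelow⇒ (TripleOK.rimRung≢rimRung↑ (triple q)) r<m)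
                                                         (isFirst-kind-suc n j))
      ; rimRung≢spoke          = λ _ _ q r<m → ≢ᵇ⇒≢ (AllBelow⇒ (TripleOK.rimRung≢spoke (triple q)) r<m)
      ; rimRung≢rimEdge        = λ _ _ q r<m → ≢ᵇ⇒≢ (AllBelow⇒ (TripleOK.rimRung≢rimEdge (triple q)) r<m)
      ; rimRung≢rimEdge-prev   = λ _ _ q r<m → ≢ᵇ⇒≢ (AllBelow⇒ (TripleOK.rimRung≢rimEdge-prev (triple q)) r<m)
      ; rimRung≢spoke↑         = λ _ _ q r<m → ≢ᵇ⇒≢ (AllBelow⇒ (TripleOK.rimRung≢spoke↑ (triple q)) r<m)
      ; rimRung≢rimEdge↑       = λ _ _ q r<m → ≢ᵇ⇒≢ (AllBelow⇒ (TripleOK.rimRung≢rimEdge↑ (triple q)) r<m)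
      ; rimRung≢rimEdge-prev↑  = λ _ _ q r<m → ≢ᵇ⇒≢ (AllBelow⇒ (TripleOK.rimRung≢rimEdge-prev↑ (triple q)) r<m)
      ; spoke≢rimEdge          = λ _ _ j<n r<m → ≢ᵇ⇒≢ (AllBelow⇒ (PairOK.spoke≢rimEdge (pair j<n)) r<m)
      ; spoke≢rimEdge-prev     = λ _ _ j<n r<m → ≢ᵇ⇒≢ (AllBelow⇒ (PairOK.spoke≢rimEdge-prev (pair j<n)) r<m)
      ; rimEdge≢rimEdge-prev   = λ _ _ j<n r<m → ≢ᵇ⇒≢ (AllBelow⇒ (PairOK.rimEdge≢rimEdge-prev (pair j<n)) r<m)
      ; centreRung≢centre      = λ _ q → ≢ᵇ⇒≢ (TripleOK.centreRung≢centre (triple q))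
      ; rimRung≢rim            = λ _ _ q r<m → ≢ᵇ⇒≢ (AllBelow⇒ (TripleOK.rimRung≢rim (triple q)) r<m)
      ; centreRung≢centre↑     = λ _ q → ≢ᵇ⇒≢ (TripleOK.centreRung≢centre↑ (triple q))
      ; rimRung≢rim↑           = λ _ _ q r<m → ≢ᵇ⇒≢ (AllBelow⇒ (TripleOK.rimRung≢rim↑ (triple q)) r<m)
      ; spoke≢centre           = λ _ _ j<n r<m → ≢ᵇ⇒≢ (AllBelow⇒ (PairOK.spoke≢centre (pair j<n)) r<m)
      ; spoke≢rim              = λ _ _ j<n r<m → ≢ᵇ⇒≢ (AllBelow⇒ (PairOK.spoke≢rim (pair j<n)) r<m)
      ; rimEdge≢rim            = λ _ _ j<n r<m → ≢ᵇ⇒≢ (AllBelow⇒ (PairOK.rimEdge≢rim (pair j<n)) r<m)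
      ; rimEdge≢rim-next       = λ _ _ j<n r<m → ≢ᵇ⇒≢ (AllBelow⇒ (PairOK.rimEdge≢rim-next (pair j<n)) r<m)
      ; weight-centre≢rim      = λ _ r j<n r<m e → ≢ᵇ⇒≢ (AllBelow⇒ (PairOK.weight-centre≢rim (pair j<n)) r<m)
          (trans (sym (centreWeight≡ j<n)) (trans e (rimWeight≡ r j<n)))
      ; weight-rim≢rim-next    = λ _ r j<n r<m e → ≢ᵇ⇒≢ (AllBelow⇒ (PairOK.weight-rim≢rim-next (pair j<n)) r<m)
          (trans (sym (rimWeight≡ r j<n)) (trans e (rimWeight≡ (next r) j<n)))
      ; weight-centre≢centre↑  = λ _ q e → ≢ᵇ⇒≢ (TripleOK.weight-centre≢centre↑ (triple q))
          (trans (sym (centreWeight≡ (<-trans (n<1+n _) q))) (trans e (centreWeight≡ q)))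
      ; weight-rim≢rim↑        = λ _ r q r<m e → ≢ᵇ⇒≢ (AllBelow⇒ (TripleOK.weight-rim≢rim↑ (triple q)) r<m)
          (trans (sym (rimWeight≡ r (<-trans (n<1+n _) q))) (trans e (rimWeight≡ r q)))
      }

  hasKindColouring : Every (λ (P , Q) → PairOK P Q) (kindPairs n) →
                     Every (λ (P , Q , R) → TripleOK P Q R) (kindTriples n) → HasSumDistTotal G k
  hasKindColouring pairs triples = hasSumDistTotal (admissible pairs triples)

nth : List ℕ → ℕ → ℕ
nth []       _       = 0
nth (x ∷ xs) zero    = x
nth (x ∷ xs) (suc i) = nth xs i

table : (centre centreRung : Kind → ℕ) (rim spoke rimEdge rimRung : Kind → List ℕ) → Palette Kind
table centre centreRung rim spoke rimEdge rimRung = record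
  { centre = centre ; centreRung = centreRung
  ; rim = nth ∘ rim ; spoke = nth ∘ spoke ; rimEdge = nth ∘ rimEdge ; rimRung = nth ∘ rimRung }

module SmallWheels where

  W₃ : Palette Kind
  W₃ = table centre centreRung rim spoke rimEdge rimRung
    where
    centre centreRung : Kind → ℕ
    centre first   = 1
    centre middle₁ = 4
    centre middle₀ = 2
    centre last    = 1
    centreRung first   = 2
    centreRung middle₁ = 7
    centreRung middle₀ = 3
    centreRung last    = 0
    rim spoke rimEdge rimRung : Kind → List ℕ
    spoke first   = 4 ∷ 5 ∷ 6 ∷ []
    spoke middle₁ = 1 ∷ 5 ∷ 6 ∷ []
    spoke middle₀ = 5 ∷ 4 ∷ 6 ∷ []
    spoke last    = 4 ∷ 5 ∷ 6 ∷ []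
    rim first   = 3 ∷ 2 ∷ 4 ∷ []
    rim middle₁ = 2 ∷ 1 ∷ 3 ∷ []
    rim middle₀ = 4 ∷ 5 ∷ 1 ∷ []
    rim last    = 3 ∷ 2 ∷ 4 ∷ []
    rimRung first   = 5 ∷ 6 ∷ 1 ∷ []
    rimRung middle₁ = 7 ∷ 7 ∷ 7 ∷ []
    rimRung middle₀ = 6 ∷ 6 ∷ 5 ∷ []
    rimRung last    = []
    rimEdge middle₁ = 3 ∷ 2 ∷ 4 ∷ []
    rimEdge _       = 1 ∷ 3 ∷ 2 ∷ []

  W₃P₂ : Palette Kind
  W₃P₂ = table centre (λ _ → 2) rim spoke (λ _ → 1 ∷ 3 ∷ 2 ∷ []) (λ _ → 5 ∷ 6 ∷ 1 ∷ [])
    where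
    centre : Kind → ℕ
    centre first = 1
    centre _     = 3
    rim spoke : Kind → List ℕ
    spoke first = 4 ∷ 5 ∷ 6 ∷ []
    spoke _     = 6 ∷ 4 ∷ 5 ∷ []
    rim first = 3 ∷ 2 ∷ 4 ∷ []
    rim _     = 4 ∷ 5 ∷ 6 ∷ []

  W₄P₂ : Palette Kind
  W₄P₂ = table centre (λ _ → 2) rim spoke (λ _ → 1 ∷ 2 ∷ 1 ∷ 2 ∷ []) (λ _ → 5 ∷ 6 ∷ 4 ∷ 3 ∷ [])
    where
    centre : Kind → ℕ
    centre first = 1
    centre _     = 3
    rim spoke : Kind → List ℕ
    spoke first = 4 ∷ 3 ∷ 5 ∷ 6 ∷ []
    spoke _     = 6 ∷ 7 ∷ 5 ∷ 4 ∷ []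
    rim first = 3 ∷ 4 ∷ 3 ∷ 4 ∷ []
    rim _     = 4 ∷ 5 ∷ 6 ∷ 5 ∷ []

  W₄P₃ : Palette Kind
  W₄P₃ = table centre centreRung rim spoke rimEdge rimRung
    where
    centre centreRung : Kind → ℕ
    centre middle₁ = 3
    centre _       = 1
    centreRung first = 2
    centreRung _     = 7
    rim spoke rimEdge rimRung : Kind → List ℕ
    spoke middle₁ = 4 ∷ 5 ∷ 6 ∷ 1 ∷ []
    spoke _       = 4 ∷ 3 ∷ 5 ∷ 6 ∷ []
    rim middle₁ = 7 ∷ 2 ∷ 1 ∷ 6 ∷ []
    rim _       = 3 ∷ 4 ∷ 3 ∷ 4 ∷ []
    rimRung first = 5 ∷ 6 ∷ 4 ∷ 3 ∷ []
    rimRung _     = 6 ∷ 7 ∷ 7 ∷ 7 ∷ []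
    rimEdge middle₁ = 1 ∷ 3 ∷ 5 ∷ 2 ∷ []
    rimEdge _       = 1 ∷ 2 ∷ 1 ∷ 2 ∷ []

  W₄ : Palette Kind
  W₄ = table centre centreRung rim spoke rimEdge rimRung
    where
    centre centreRung : Kind → ℕ
    centre first   = 1
    centre middle₁ = 3
    centre middle₀ = 2
    centre last    = 1
    centreRung first   = 2
    centreRung middle₁ = 8
    centreRung middle₀ = 7
    centreRung last    = 0
    rim spoke rimEdge rimRung : Kind → List ℕ
    spoke middle₁ = 4 ∷ 5 ∷ 1 ∷ 6 ∷ []
    spoke middle₀ = 3 ∷ 4 ∷ 5 ∷ 6 ∷ []
    spoke _       = 4 ∷ 3 ∷ 5 ∷ 6 ∷ []
    rim middle₁ = 6 ∷ 7 ∷ 2 ∷ 1 ∷ []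
    rim middle₀ = 4 ∷ 3 ∷ 4 ∷ 3 ∷ []
    rim _       = 3 ∷ 4 ∷ 3 ∷ 4 ∷ []
    rimRung first   = 5 ∷ 6 ∷ 4 ∷ 3 ∷ []
    rimRung middle₁ = 7 ∷ 8 ∷ 8 ∷ 8 ∷ []
    rimRung middle₀ = 5 ∷ 6 ∷ 6 ∷ 5 ∷ []
    rimRung last    = []
    rimEdge middle₁ = 1 ∷ 3 ∷ 7 ∷ 2 ∷ []
    rimEdge _       = 1 ∷ 2 ∷ 1 ∷ 2 ∷ []

  has-W₃P₂ : HasSumDistTotal (wheel 3 □ pathGraph 2) 6
  has-W₃P₂ = KindColouring.hasKindColouring 0 2 6 (s≤s (s≤s z≤n)) W₃P₂ _ _

  has-W₃P₃ : HasSumDistTotal (wheel 3 □ pathGraph 3) 7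
  has-W₃P₃ = KindColouring.hasKindColouring 0 3 7 (s≤s (s≤s z≤n)) W₃ _ _

  has-W₃P : ∀ n′ → HasSumDistTotal (wheel 3 □ pathGraph (4 + n′)) 7
  has-W₃P n′ = KindColouring.hasKindColouring 0 (4 + n′) 7 (s≤s (s≤s z≤n)) W₃ _ _

  has-W₄P₂ : HasSumDistTotal (wheel 4 □ pathGraph 2) 7
  has-W₄P₂ = KindColouring.hasKindColouring 1 2 7 (s≤s (s≤s z≤n)) W₄P₂ _ _

  has-W₄P₃ : HasSumDistTotal (wheel 4 □ pathGraph 3) 7
  has-W₄P₃ = KindColouring.hasKindColouring 1 3 7 (s≤s (s≤s z≤n)) W₄P₃ _ _

  has-W₄P : ∀ n′ → HasSumDistTotal (wheel 4 □ pathGraph (4 + n′)) 8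
  has-W₄P n′ = KindColouring.hasKindColouring 1 (4 + n′) 8 (s≤s (s≤s z≤n)) W₄ _ _

hasSumDistTotal-resp : ∀ {G k k′} → k ≡ k′ → HasSumDistTotal G k → HasSumDistTotal G k′
hasSumDistTotal-resp {G} = subst (HasSumDistTotal G)

-- The lower-bound witnesses: in W_m □ P_2 the two centres, which have maximum degree
-- m + 1; for n ≥ 3 the centres of the inner layers, of maximum degree m + 2.
chiSigma-P₂ : ∀ m0 → let G = wheel (3 + m0) □ pathGraph 2 in
  HasSumDistTotal G (6 + m0) → ChiSigmaIs G (maxDegree G + 2)
chiSigma-P₂ m0 has = chiSigma-Δ+2 G x y (adj-vertex Fin.zero Fin.zero Fin.zero (Fin.suc Fin.zero) tt)
  (trans dx (sym Δ≡)) (trans dy (sym Δ≡))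
  (hasSumDistTotal-resp (trans (cong (4 +_) (+-comm 2 m0)) (cong (_+ 2) (sym Δ≡))) has)
  where
  open Degrees m0 2
  x y : Fin (V G)
  x = vertex Fin.zero Fin.zero
  y = vertex Fin.zero (Fin.suc Fin.zero)
  dx : degree G x ≡ 1 + m
  dx = trans (degree-vertex Fin.zero Fin.zero) (cong suc (centre-wheelDegree 0))
  dy : degree G y ≡ 1 + m
  dy = trans (degree-vertex Fin.zero (Fin.suc Fin.zero)) (cong suc (centre-wheelDegree 1))
  Δ≡ : maxDegree G ≡ 1 + m
  Δ≡ = maxDegree≡ G x (degree≤ bound) dx
    where
    bound : ∀ a l → a < suc m → l < 2 → degreeℕ a l ≤ 1 + m
    bound a 0 _ _ = s≤s (wheelDegree≤m a 0)
    bound a 1 _ _ = s≤s (wheelDegree≤m a 1)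
    bound a (suc (suc _)) _ (s≤s (s≤s ()))

degree-inner-centre : ∀ m0 n′ →
  degree (wheel (3 + m0) □ pathGraph (3 + n′)) (Degrees.vertex m0 (3 + n′) Fin.zero (Fin.suc Fin.zero)) ≡ 5 + m0
degree-inner-centre m0 n′ =
  trans (degree-vertex Fin.zero (Fin.suc Fin.zero)) (cong (2 +_) (centre-wheelDegree 1))
  where open Degrees m0 (3 + n′)

maxDegree-P₃₊ : ∀ m0 n′ → maxDegree (wheel (3 + m0) □ pathGraph (3 + n′)) ≡ 5 + m0
maxDegree-P₃₊ m0 n′ = maxDegree≡ G (vertex Fin.zero (Fin.suc Fin.zero)) degree≤2+m (degree-inner-centre m0 n′)
  where open Degrees m0 (3 + n′)

chiSigma-P₃ : ∀ m0 → let G = wheel (3 + m0) □ pathGraph 3 in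
  HasSumDistTotal G (6 + m0) → ChiSigmaIs G (maxDegree G + 1)
chiSigma-P₃ m0 has = chiSigma-Δ+1 G (vertex Fin.zero (Fin.suc Fin.zero)) (trans dx (sym Δ≡))
  (hasSumDistTotal-resp (trans (cong (5 +_) (+-comm 1 m0)) (cong (_+ 1) (sym Δ≡))) has)
  where
  open Degrees m0 3
  Δ≡ : maxDegree G ≡ 5 + m0
  Δ≡ = maxDegree-P₃₊ m0 0
  dx : degree G (vertex Fin.zero (Fin.suc Fin.zero)) ≡ 5 + m0
  dx = degree-inner-centre m0 0

-- In W_3 □ P_3 the rim vertices of the middle layer also have degree 5.
chiSigma-W₃P₃ : let G = wheel 3 □ pathGraph 3 in
  HasSumDistTotal G 7 → ChiSigmaIs G (maxDegree G + 2)
chiSigma-W₃P₃ has = chiSigma-Δ+2 G x y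
  (adj-vertex Fin.zero (Fin.suc Fin.zero) (Fin.suc Fin.zero) (Fin.suc Fin.zero) tt)
  (trans dx (sym Δ≡)) (trans dy (sym Δ≡))
  (hasSumDistTotal-resp (cong (_+ 2) (sym Δ≡)) has)
  where
  open Degrees 0 3
  x y : Fin (V G)
  x = vertex Fin.zero (Fin.suc Fin.zero)
  y = vertex (Fin.suc Fin.zero) (Fin.suc Fin.zero)
  Δ≡ : maxDegree G ≡ 5
  Δ≡ = maxDegree-P₃₊ 0 0
  dx : degree G x ≡ 5
  dx = degree-inner-centre 0 0
  dy : degree G y ≡ 5
  dy = degree-vertex (Fin.suc Fin.zero) (Fin.suc Fin.zero)

chiSigma-P₄₊ : ∀ m0 n′ → let G = wheel (3 + m0) □ pathGraph (4 + n′) in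
  HasSumDistTotal G (7 + m0) → ChiSigmaIs G (maxDegree G + 2)
chiSigma-P₄₊ m0 n′ has = chiSigma-Δ+2 G x y
  (adj-vertex Fin.zero (Fin.suc Fin.zero) Fin.zero (Fin.suc (Fin.suc Fin.zero)) tt)
  (trans dx (sym Δ≡)) (trans dy (sym Δ≡))
  (hasSumDistTotal-resp (trans (cong (5 +_) (+-comm 2 m0)) (cong (_+ 2) (sym Δ≡))) has)
  where
  open Degrees m0 (4 + n′)
  x y : Fin (V G)
  x = vertex Fin.zero (Fin.suc Fin.zero)
  y = vertex Fin.zero (Fin.suc (Fin.suc Fin.zero))
  Δ≡ : maxDegree G ≡ 2 + m
  Δ≡ = maxDegree-P₃₊ m0 (suc n′)
  dx : degree G x ≡ 2 + m
  dx = degree-inner-centre m0 (suc n′)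
  dy : degree G y ≡ 2 + m
  dy = trans (degree-vertex Fin.zero (Fin.suc (Fin.suc Fin.zero))) (cong (2 +_) (centre-wheelDegree 2))

has-P₂ : ∀ m0 → HasSumDistTotal (wheel (3 + m0) □ pathGraph 2) (6 + m0)
has-P₂ 0              = SmallWheels.has-W₃P₂
has-P₂ 1              = SmallWheels.has-W₄P₂
has-P₂ (suc (suc m1)) = ModularInstances.TwoLayers.has m1

has-P₃ : ∀ m0 → HasSumDistTotal (wheel (4 + m0) □ pathGraph 3) (7 + m0)
has-P₃ 0        = SmallWheels.has-W₄P₃
has-P₃ (suc m1) = ModularInstances.ThreeLayers.has m1

has-P₄₊ : ∀ m0 n′ → HasSumDistTotal (wheel (3 + m0) □ pathGraph (4 + n′)) (7 + m0)
has-P₄₊ 0              n′ = SmallWheels.has-W₃P n′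
has-P₄₊ 1              n′ = SmallWheels.has-W₄P n′
has-P₄₊ (suc (suc m1)) n′ = ModularInstances.ManyLayers.has m1 n′

theorem4p5 : (m n : ℕ) → 3 ≤ m → 2 ≤ n →
    ((n ≡ 3 × 4 ≤ m) → ChiSigmaIs (wheel m □ pathGraph n) (maxDegree (wheel m □ pathGraph n) + 1))
    × (¬ (n ≡ 3 × 4 ≤ m) → ChiSigmaIs (wheel m □ pathGraph n) (maxDegree (wheel m □ pathGraph n) + 2))
theorem4p5 (suc (suc (suc m0))) 2 (s≤s (s≤s (s≤s _))) _ =
  (λ { (() , _) }) , λ _ → chiSigma-P₂ m0 (has-P₂ m0)
theorem4p5 3 3 _ _ =
  (λ { (_ , s≤s (s≤s (s≤s ()))) }) , λ _ → chiSigma-W₃P₃ SmallWheels.has-W₃P₃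
theorem4p5 (suc (suc (suc (suc m0)))) 3 _ _ =
  (λ _ → chiSigma-P₃ (suc m0) (has-P₃ m0)) ,
  λ ¬n≡3∧4≤m → ⊥-elim (¬n≡3∧4≤m (refl , s≤s (s≤s (s≤s (s≤s z≤n)))))
theorem4p5 (suc (suc (suc m0))) (suc (suc (suc (suc n′)))) (s≤s (s≤s (s≤s _))) _ =
  (λ { (() , _) }) , λ _ → chiSigma-P₄₊ m0 n′ (has-P₄₊ m0 n′)
theorem4p5 1 _ (s≤s ()) _
theorem4p5 2 _ (s≤s (s≤s ())) _
theorem4p5 _ 1 _ (s≤s ())
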